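{- For every integer $k\geq1$, let $\mathcal{T}_k$ be the class of graphs of treewidth at most $k$. Then \[\max_{G\in\mathcal{T}_k}\operatorname{sa}(G)=\max_{G\in\mathcal{T}_k}\operatorname{gsa}(G)=\max_{G\in\mathcal{T}_k}\operatorname{bsa}(G)=k+1.\]
   Context: Graphs are finite, simple and undirected. A $k$-tree is defined recursively: $K_{k+1}$ is a $k$-tree, and if $G$ has a vertex $v$ whose neighbourhood is a $k$-clique and $G-v$ is a $k$-tree then $G$ is a $k$-tree. The treewidth of $G$ is the minimum $k$ such that $G$ is a spanning subgraph of a $k$-tree. A star is a tree of diameter at most 2; a star-forest is a graph each of whose components is a star. The star-arboricity $\operatorname{sa}(G)$ is the minimum number of star-forests whose edge sets partition $E(G)$. A geometric drawing of $G$ maps vertices injectively to points of $\mathbb{R}^2$ and each edge to the straight segment between its endpoints, with no edge containing a vertex other than its endpoints; a book embedding is a geometric drawing whose vertices are in convex position. Two edges cross if they intersect at a point other than a common endpoint. The geometric star-arboricity $\operatorname{gsa}(G)$ (resp. book star-arboricity $\operatorname{bsa}(G)$) is the minimum $t$ such that some geometric drawing (resp. book embedding) of $G$ has its edges partitioned into $t$ classes, each forming a star-forest with no two of its edges crossing.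
   Formalization: The vertices of every geometric drawing and book embedding are placed at points of ℚ² instead of $\mathbb{R}^2$. -}

module Defs where

open import Data.Nat using (ℕ; zero; suc) renaming (_≤_ to _≤ℕ_)
open import Data.Fin using (Fin; punchIn)
open import Data.Bool using (Bool; true; false)
open import Data.Product using (Σ; ∃; ∃-syntax; _×_; _,_)
open import Data.Sum using (_⊎_)
open import Data.Rational using (ℚ; 0ℚ; 1ℚ; _+_; _*_; _-_; _≤_)
open import Relation.Binary.PropositionalEquality using (_≡_; _≢_)
open import Relation.Nullary using (¬_)

record Graph : Set where
  field
    n      : ℕ
    adj    : Fin n → Fin n → Bool
    sym    : ∀ i j → adj i j ≡ adj j i
    irrefl : ∀ i → adj i i ≡ false
open Graph public

Edge : (G : Graph) → Fin (n G) → Fin (n G) → Set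
Edge G i j = adj G i j ≡ true

-- k-trees (recursive definition), on a raw adjacency relation.
-- base: K_{k+1};  step: a vertex v whose neighbourhood is a k-clique
-- (the image of an injection f : Fin k → vertices of G - v, all pairwise
-- adjacent), and G - v (vertex removal via punchIn) is a k-tree.

data IsKTree (k : ℕ) : (m : ℕ) → (Fin m → Fin m → Bool) → Set where
  base : (a : Fin (suc k) → Fin (suc k) → Bool) →
         (∀ i j → i ≢ j → a i j ≡ true) →
         IsKTree k (suc k) a
  step : {m : ℕ} (a : Fin (suc m) → Fin (suc m) → Bool) (v : Fin (suc m))
         (f : Fin k → Fin m) →
         (∀ x y → f x ≡ f y → x ≡ y) →
         (∀ u → a v (punchIn v u) ≡ true → ∃[ x ] f x ≡ u) →
         (∀ x → a v (punchIn v (f x)) ≡ true) →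
         (∀ x y → x ≢ y → a (punchIn v (f x)) (punchIn v (f y)) ≡ true) →
         IsKTree k m (λ i j → a (punchIn v i) (punchIn v j)) →
         IsKTree k (suc m) a

SpanningSubOfKTree : ℕ → Graph → Set
SpanningSubOfKTree k G =
  Σ (Fin (n G) → Fin (n G) → Bool) λ h →
    (∀ i j → h i j ≡ h j i) × (∀ i → h i i ≡ false) ×
    IsKTree k (n G) h × (∀ i j → Edge G i j → h i j ≡ true)

-- treewidth(G) ≤ k  (treewidth = least k' with G spanning subgraph of a k'-tree)
TreewidthLE : Graph → ℕ → Set
TreewidthLE G k = ∃[ k' ] (k' ≤ℕ k × SpanningSubOfKTree k' G)

record EdgeColouring (G : Graph) (t : ℕ) : Set where
  field
    col    : Fin (n G) → Fin (n G) → Fin t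
    colSym : ∀ i j → Edge G i j → col i j ≡ col j i
open EdgeColouring public

ColEdge : {G : Graph} {t : ℕ} → EdgeColouring G t → Fin t →
          Fin (n G) → Fin (n G) → Set
ColEdge {G} c a i j = Edge G i j × col c i j ≡ a

-- The colour class a is a star forest: it contains no triangle and no
-- path with three edges (equivalently, every component is a tree of
-- diameter ≤ 2).
IsStarForestClass : {G : Graph} {t : ℕ} → EdgeColouring G t → Fin t → Set
IsStarForestClass {G} c a =
  (¬ Σ (Fin (n G)) λ x → Σ (Fin (n G)) λ y → Σ (Fin (n G)) λ z →
       ColEdge c a x y × ColEdge c a y z × ColEdge c a z x) ×
  (¬ Σ (Fin (n G)) λ w → Σ (Fin (n G)) λ x → Σ (Fin (n G)) λ y → Σ (Fin (n G)) λ z →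
       w ≢ y × x ≢ z × w ≢ z ×
       ColEdge c a w x × ColEdge c a x y × ColEdge c a y z)

StarColouring : (G : Graph) (t : ℕ) → EdgeColouring G t → Set
StarColouring G t c = ∀ a → IsStarForestClass c a

SaLE : Graph → ℕ → Set
SaLE G t = Σ (EdgeColouring G t) λ c → StarColouring G t c

Point : Set
Point = ℚ × ℚ

lerp : Point → Point → ℚ → Point
lerp (x₁ , y₁) (x₂ , y₂) s = (x₁ + s * (x₂ - x₁) , y₁ + s * (y₂ - y₁))

InUnit : ℚ → Set
InUnit s = 0ℚ ≤ s × s ≤ 1ℚ

OnSegment : Point → Point → Point → Set
OnSegment p a b = ∃[ s ] (InUnit s × p ≡ lerp a b s)

sumℚ : {m : ℕ} → (Fin m → ℚ) → ℚ
sumℚ {zero}  f = 0ℚ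
sumℚ {suc m} f = f Fin.zero + sumℚ (λ i → f (Fin.suc i))
  where import Data.Fin as Fin

InHullOfOthers : {m : ℕ} → (Fin m → Point) → Fin m → Set
InHullOfOthers {m} pos i =
  Σ (Fin m → ℚ) λ w →
    (∀ j → 0ℚ ≤ w j) × w i ≡ 0ℚ × sumℚ w ≡ 1ℚ ×
    sumℚ (λ j → w j * Data.Product.proj₁ (pos j)) ≡ Data.Product.proj₁ (pos i) ×
    sumℚ (λ j → w j * Data.Product.proj₂ (pos j)) ≡ Data.Product.proj₂ (pos i)
  where import Data.Product

record Drawing (G : Graph) : Set where
  field
    pos      : Fin (n G) → Point
    posInj   : ∀ i j → pos i ≡ pos j → i ≡ j
    noThrough : ∀ i j v → Edge G i j → v ≢ i → v ≢ j →
                ¬ OnSegment (pos v) (pos i) (pos j)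
open Drawing public

ConvexPosition : {G : Graph} → Drawing G → Set
ConvexPosition D = ∀ i → ¬ InHullOfOthers (pos D) i

Cross : {G : Graph} → Drawing G → (i j k l : Fin (n G)) → Set
Cross {G} D i j k l =
  Σ ℚ λ s → Σ ℚ λ t → InUnit s × InUnit t ×
    lerp (pos D i) (pos D j) s ≡ lerp (pos D k) (pos D l) t ×
    (∀ u → (u ≡ i ⊎ u ≡ j) → (u ≡ k ⊎ u ≡ l) →
       lerp (pos D i) (pos D j) s ≢ pos D u)

SameEdge : {m : ℕ} → (i j k l : Fin m) → Set
SameEdge i j k l = (i ≡ k × j ≡ l) ⊎ (i ≡ l × j ≡ k)

NonCrossingClasses : {G : Graph} {t : ℕ} → Drawing G → EdgeColouring G t → Set
NonCrossingClasses {G} D c =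
  ∀ a i j k l → ColEdge c a i j → ColEdge c a k l → ¬ SameEdge i j k l →
    ¬ Cross D i j k l

GsaLE : Graph → ℕ → Set
GsaLE G t = Σ (Drawing G) λ D → Σ (EdgeColouring G t) λ c →
  StarColouring G t c × NonCrossingClasses D c

BsaLE : Graph → ℕ → Set
BsaLE G t = Σ (Drawing G) λ D → ConvexPosition D × Σ (EdgeColouring G t) λ c →
  StarColouring G t c × NonCrossingClasses D c

-- max_{G ∈ T_k} f(G) = k+1, where "f(G) ≤ t" is given by LE
MaxOverTwEq : (Graph → ℕ → Set) → ℕ → Set
MaxOverTwEq LE k =
  (∀ G → TreewidthLE G k → LE G (suc k)) ×
  (∃[ G ] (TreewidthLE G k × LE G (suc k) × ¬ LE G k))

{-# OPTIONS --safe #-}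
-- Upper bound: build the k-tree vertex by vertex and keep a colouring with k + 1 colours in
-- which the edges from a vertex to its older neighbours get distinct colours, no
-- monochromatic path descends in age twice, and every vertex misses a colour on its edges to
-- older neighbours. Then every colour class is a forest of stars centred at their oldest
-- vertex. A new vertex v attached to a k-clique with youngest member w colours vw by the
-- colour missing at w and every other vu like wu. Vertices lie on the parabola y = x², where
-- two chords cross iff their endpoints interleave; v is placed right next to w, so vu
-- crosses exactly the chords that wu crosses.
--
-- Lower bound: attach to a k-clique A more than k² vertices b, each adjacent to A and to a
-- private vertex joined to k - 1 vertices of A. With k colours some b has two edges of one
-- colour, which makes a vertex of A a leaf of b's star in that colour; the pair (vertex of A,
-- colour) then determines b.
module Submission where

open import Defs hiding (sym)
open import Data.Nat as ℕ using (ℕ; zero; suc; _≥_; s≤s; z≤n)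
import Data.Nat.Properties as ℕ
open import Data.Fin as Fin using (Fin; punchIn; punchOut; toℕ)
import Data.Fin.Properties as Fin
open import Data.Bool using (Bool; true; false; not)
open import Data.Product using (∃; ∃-syntax; _×_; _,_; proj₁; proj₂)
open import Data.Sum using (_⊎_; inj₁; inj₂; [_,_]′)
open import Data.Empty using (⊥; ⊥-elim)
open import Function using (_∘_; _∘′_; id)
open import Relation.Nullary using (¬_; Dec; yes; no; does)
open import Relation.Binary.Definitions using (tri<; tri≈; tri>)
open import Relation.Binary.PropositionalEquality

module Interleaving where
  open import Data.Nat using (_<_)

  -- Chords ab and cd of a convex curve cross iff their endpoints alternate along
  -- the curve; each constructor is named after the order of the four endpoints.
  data Interleaved {T : Set} (_≺_ : T → T → Set) (a b c d : T) : Set where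
    acbd : a ≺ c → c ≺ b → b ≺ d → Interleaved _≺_ a b c d
    adbc : a ≺ d → d ≺ b → b ≺ c → Interleaved _≺_ a b c d
    bcad : b ≺ c → c ≺ a → a ≺ d → Interleaved _≺_ a b c d
    bdac : b ≺ d → d ≺ a → a ≺ c → Interleaved _≺_ a b c d
    cadb : c ≺ a → a ≺ d → d ≺ b → Interleaved _≺_ a b c d
    cbda : c ≺ b → b ≺ d → d ≺ a → Interleaved _≺_ a b c d
    dacb : d ≺ a → a ≺ c → c ≺ b → Interleaved _≺_ a b c d
    dbca : d ≺ b → b ≺ c → c ≺ a → Interleaved _≺_ a b c d

  module _ {T : Set} {_≺_ : T → T → Set} where

    Interleaved-swapˡ : ∀ {a b c d} → Interleaved _≺_ a b c d → Interleaved _≺_ b a c d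
    Interleaved-swapˡ (acbd p q r) = bcad p q r
    Interleaved-swapˡ (adbc p q r) = bdac p q r
    Interleaved-swapˡ (bcad p q r) = acbd p q r
    Interleaved-swapˡ (bdac p q r) = adbc p q r
    Interleaved-swapˡ (cadb p q r) = cbda p q r
    Interleaved-swapˡ (cbda p q r) = cadb p q r
    Interleaved-swapˡ (dacb p q r) = dbca p q r
    Interleaved-swapˡ (dbca p q r) = dacb p q r

    Interleaved-sym : ∀ {a b c d} → Interleaved _≺_ a b c d → Interleaved _≺_ c d a b
    Interleaved-sym (acbd p q r) = cadb p q r
    Interleaved-sym (adbc p q r) = cbda p q r
    Interleaved-sym (bcad p q r) = dacb p q r
    Interleaved-sym (bdac p q r) = dbca p q r
    Interleaved-sym (cadb p q r) = acbd p q r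
    Interleaved-sym (cbda p q r) = adbc p q r
    Interleaved-sym (dacb p q r) = bcad p q r
    Interleaved-sym (dbca p q r) = bdac p q r

    Interleaved-swapʳ : ∀ {a b c d} → Interleaved _≺_ a b c d → Interleaved _≺_ a b d c
    Interleaved-swapʳ = Interleaved-sym ∘′ Interleaved-swapˡ ∘′ Interleaved-sym

    Interleaved-cong : ∀ {a b c d a′ b′ c′ d′} → a ≡ a′ → b ≡ b′ → c ≡ c′ → d ≡ d′ →
      Interleaved _≺_ a b c d → Interleaved _≺_ a′ b′ c′ d′
    Interleaved-cong refl refl refl refl i = i

    Interleaved-reflect : {U : Set} {_⊏_ : U → U → Set} (f : T → U) →
      (∀ {x y} → f x ⊏ f y → x ≺ y) → ∀ {a b c d} →
      Interleaved _⊏_ (f a) (f b) (f c) (f d) → Interleaved _≺_ a b c d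
    Interleaved-reflect f r (acbd p q s) = acbd (r p) (r q) (r s)
    Interleaved-reflect f r (adbc p q s) = adbc (r p) (r q) (r s)
    Interleaved-reflect f r (bcad p q s) = bcad (r p) (r q) (r s)
    Interleaved-reflect f r (bdac p q s) = bdac (r p) (r q) (r s)
    Interleaved-reflect f r (cadb p q s) = cadb (r p) (r q) (r s)
    Interleaved-reflect f r (cbda p q s) = cbda (r p) (r q) (r s)
    Interleaved-reflect f r (dacb p q s) = dacb (r p) (r q) (r s)
    Interleaved-reflect f r (dbca p q s) = dbca (r p) (r q) (r s)

  private
    Interleaved⇒≢ : ∀ {a b c d} → Interleaved _<_ a b c d → a ≢ c
    Interleaved⇒≢ (acbd p q r) = ℕ.<⇒≢ p
    Interleaved⇒≢ (adbc p q r) = ℕ.<⇒≢ (ℕ.<-trans p (ℕ.<-trans q r))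
    Interleaved⇒≢ (bcad p q r) = ℕ.<⇒≢ q ∘ sym
    Interleaved⇒≢ (bdac p q r) = ℕ.<⇒≢ r
    Interleaved⇒≢ (cadb p q r) = ℕ.<⇒≢ p ∘ sym
    Interleaved⇒≢ (cbda p q r) = ℕ.<⇒≢ (ℕ.<-trans p (ℕ.<-trans q r)) ∘ sym
    Interleaved⇒≢ (dacb p q r) = ℕ.<⇒≢ q
    Interleaved⇒≢ (dbca p q r) = ℕ.<⇒≢ r ∘ sym

  Interleaved⇒distinct : ∀ {a b c d} → Interleaved _<_ a b c d → a ≢ c × a ≢ d × b ≢ c × b ≢ d
  Interleaved⇒distinct i =
    Interleaved⇒≢ i , Interleaved⇒≢ (Interleaved-swapʳ i) ,
    Interleaved⇒≢ (Interleaved-swapˡ i) , Interleaved⇒≢ (Interleaved-swapˡ (Interleaved-swapʳ i))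

  ¬Interleaved-adjacent : ∀ {n c d} → ¬ Interleaved _<_ (suc n) n c d
  ¬Interleaved-adjacent = λ where
      (acbd p q _) → gap′ p q
      (adbc p q _) → gap′ p q
      (bcad p q _) → gap p q
      (bdac p q _) → gap p q
      (cadb _ q r) → gap′ q r
      (cbda _ q r) → gap q r
      (dacb _ q r) → gap′ q r
      (dbca _ q r) → gap q r
    where
    gap : ∀ {n x} → n < x → x < suc n → ⊥
    gap p q = ℕ.<-irrefl refl (ℕ.<-≤-trans p (ℕ.m<1+n⇒m≤n q))
    gap′ : ∀ {n x} → suc n < x → x < n → ⊥
    gap′ p q = ℕ.<-asym p (ℕ.<-trans q (ℕ.n<1+n _))

  Interleaved-lowerˡ : ∀ {n b c d} → c ≢ n → d ≢ n →
    Interleaved _<_ (suc n) b c d → Interleaved _<_ n b c d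
  Interleaved-lowerˡ c≢n d≢n = λ where
      (acbd p q r) → acbd (ℕ.<⇒≤ p) q r
      (adbc p q r) → adbc (ℕ.<⇒≤ p) q r
      (bcad p q r) → bcad p (below q c≢n) (ℕ.<⇒≤ r)
      (bdac p q r) → bdac p (below q d≢n) (ℕ.<⇒≤ r)
      (cadb p q r) → cadb (below p c≢n) (ℕ.<⇒≤ q) r
      (cbda p q r) → cbda p q (below r d≢n)
      (dacb p q r) → dacb (below p d≢n) (ℕ.<⇒≤ q) r
      (dbca p q r) → dbca p q (below r c≢n)
    where
    below : ∀ {n x} → x < suc n → x ≢ n → x < n
    below p = ℕ.≤∧≢⇒< (ℕ.m<1+n⇒m≤n p)

open Interleaving

module Parabola where
  open import Data.Rational
  open import Data.Rational.Properties
  open import Algebra.Properties.Group +-0-group using (x∙y⁻¹≈ε⇒x≈y)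
  open import Data.Rational.Solver using (module +-*-Solver)
  open +-*-Solver using (solve; _:=_; _:+_; _:-_; _:*_; :-_; con)

  p-q≡0⇒p≡q : ∀ {p q} → p - q ≡ 0ℚ → p ≡ q
  p-q≡0⇒p≡q = x∙y⁻¹≈ε⇒x≈y _ _

  p*q≡0⇒p≡0⊎q≡0 : ∀ p q → p * q ≡ 0ℚ → p ≡ 0ℚ ⊎ q ≡ 0ℚ
  p*q≡0⇒p≡0⊎q≡0 p q pq≡0 with p ≟ 0ℚ
  ... | yes p≡0 = inj₁ p≡0
  ... | no p≢0 = inj₂ (begin
    q                  ≡⟨ sym (*-identityˡ q) ⟩
    1ℚ * q             ≡⟨ cong (_* q) (sym (*-inverseˡ p)) ⟩
    (1/ p) * p * q     ≡⟨ *-assoc (1/ p) p q ⟩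
    (1/ p) * (p * q)   ≡⟨ cong ((1/ p) *_) pq≡0 ⟩
    (1/ p) * 0ℚ        ≡⟨ *-zeroʳ (1/ p) ⟩
    0ℚ                 ∎)
    where
    open ≡-Reasoning
    instance _ = ≢-nonZero p≢0

  p≤q⇒0≤q-p : ∀ {p q} → p ≤ q → 0ℚ ≤ q - p
  p≤q⇒0≤q-p {p} {q} p≤q = subst (_≤ q - p) (+-inverseʳ p) (+-monoˡ-≤ (- p) p≤q)

  0≤q-p⇒p≤q : ∀ {p q} → 0ℚ ≤ q - p → p ≤ q
  0≤q-p⇒p≤q {p} {q} 0≤q-p = subst₂ _≤_ (+-identityʳ p) (p+[q-p]≡q p q) (+-monoʳ-≤ p 0≤q-p)
    where
    p+[q-p]≡q : ∀ p q → p + (q - p) ≡ q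
    p+[q-p]≡q = solve 2 (λ p q → p :+ (q :- p) := q) refl

  0≤p*q : ∀ {p q} → 0ℚ ≤ p → 0ℚ ≤ q → 0ℚ ≤ p * q
  0≤p*q {p} {q} 0≤p 0≤q = nonNegative⁻¹ (p * q)
    {{nonNeg*nonNeg⇒nonNeg p {{nonNegative 0≤p}} q {{nonNegative 0≤q}}}}

  0≤p*p : ∀ p → 0ℚ ≤ p * p
  0≤p*p p with ≤-total 0ℚ p
  ... | inj₁ 0≤p = 0≤p*q 0≤p 0≤p
  ... | inj₂ p≤0 = subst (0ℚ ≤_) (-p*-p≡p*p p) (0≤p*q 0≤-p 0≤-p)
    where
    -p*-p≡p*p : ∀ p → (- p) * (- p) ≡ p * p
    -p*-p≡p*p = solve 1 (λ p → (:- p) :* (:- p) := p :* p) refl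
    0≤-p : 0ℚ ≤ - p
    0≤-p = subst (0ℚ ≤_) (+-identityˡ (- p)) (p≤q⇒0≤q-p p≤0)

  0≤p+q : ∀ {p q} → 0ℚ ≤ p → 0ℚ ≤ q → 0ℚ ≤ p + q
  0≤p+q {p} {q} 0≤p 0≤q = subst (_≤ p + q) (+-identityʳ 0ℚ) (+-mono-≤ 0≤p 0≤q)

  p+q≡0⇒p≡0 : ∀ {p q} → 0ℚ ≤ p → 0ℚ ≤ q → p + q ≡ 0ℚ → p ≡ 0ℚ
  p+q≡0⇒p≡0 {p} 0≤p 0≤q p+q≡0 = ≤-antisym (subst₂ _≤_ (+-identityʳ p) p+q≡0 (+-monoʳ-≤ p 0≤q)) 0≤p

  p+q≡0⇒q≡0 : ∀ {p q} → 0ℚ ≤ p → 0ℚ ≤ q → p + q ≡ 0ℚ → q ≡ 0ℚ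
  p+q≡0⇒q≡0 {p} {q} 0≤p 0≤q p+q≡0 = p+q≡0⇒p≡0 0≤q 0≤p (trans (+-comm q p) p+q≡0)

  Between : ℚ → ℚ → ℚ → Set
  Between A B X = (A ≤ X × X ≤ B) ⊎ (B ≤ X × X ≤ A)

  Between-sym : ∀ {A B X} → Between A B X → Between B A X
  Between-sym (inj₁ A≤X≤B) = inj₂ A≤X≤B
  Between-sym (inj₂ B≤X≤A) = inj₁ B≤X≤A

  Between-ordered : ∀ {A B X} → A < B → Between A B X → A ≤ X × X ≤ B
  Between-ordered A<B (inj₁ A≤X≤B) = A≤X≤B
  Between-ordered A<B (inj₂ (B≤X , X≤A)) = ⊥-elim (<-irrefl refl (<-≤-trans A<B (≤-trans B≤X X≤A)))

  lerp-between : ∀ A B {s} → InUnit s → Between A B (A + s * (B - A))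
  lerp-between A B {s} (0≤s , s≤1) with ≤-total A B
  ... | inj₁ A≤B = inj₁ (0≤q-p⇒p≤q (subst (0ℚ ≤_) (X-A A B s) (0≤p*q 0≤s (p≤q⇒0≤q-p A≤B))) ,
                         0≤q-p⇒p≤q (subst (0ℚ ≤_) (B-X A B s) (0≤p*q (p≤q⇒0≤q-p s≤1) (p≤q⇒0≤q-p A≤B))))
    where
    X-A : ∀ A B s → s * (B - A) ≡ (A + s * (B - A)) - A
    X-A = solve 3 (λ A B s → s :* (B :- A) := (A :+ s :* (B :- A)) :- A) refl
    B-X : ∀ A B s → (1ℚ - s) * (B - A) ≡ B - (A + s * (B - A))
    B-X = solve 3 (λ A B s → (con 1ℚ :- s) :* (B :- A) := B :- (A :+ s :* (B :- A))) refl
  ... | inj₂ B≤A = inj₂ (0≤q-p⇒p≤q (subst (0ℚ ≤_) (X-B A B s) (0≤p*q (p≤q⇒0≤q-p s≤1) (p≤q⇒0≤q-p B≤A))) ,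
                         0≤q-p⇒p≤q (subst (0ℚ ≤_) (A-X A B s) (0≤p*q 0≤s (p≤q⇒0≤q-p B≤A))))
    where
    X-B : ∀ A B s → (1ℚ - s) * (A - B) ≡ (A + s * (B - A)) - B
    X-B = solve 3 (λ A B s → (con 1ℚ :- s) :* (A :- B) := (A :+ s :* (B :- A)) :- B) refl
    A-X : ∀ A B s → s * (A - B) ≡ A - (A + s * (B - A))
    A-X = solve 3 (λ A B s → s :* (A :- B) := A :- (A :+ s :* (B :- A))) refl

  parabola : ℚ → Point
  parabola x = x , x * x

  -- The point with abscissa X on the line through parabola A and parabola B.
  chord : ℚ → ℚ → ℚ → Point
  chord A B X = X , X * X - (X - A) * (X - B)

  lerp-parabola : ∀ A B s → lerp (parabola A) (parabola B) s ≡ chord A B (A + s * (B - A))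
  lerp-parabola A B s = cong (A + s * (B - A) ,_) (height A B s)
    where
    height : ∀ A B s → A * A + s * (B * B - A * A) ≡
      (A + s * (B - A)) * (A + s * (B - A)) - (A + s * (B - A) - A) * (A + s * (B - A) - B)
    height = solve 3 (λ A B s → A :* A :+ s :* (B :* B :- A :* A) :=
      (A :+ s :* (B :- A)) :* (A :+ s :* (B :- A)) :- ((A :+ s :* (B :- A)) :- A) :* ((A :+ s :* (B :- A)) :- B)) refl

  chord-startpoint : ∀ A B → chord A B A ≡ parabola A
  chord-startpoint A B = cong (A ,_) (height A B)
    where
    height : ∀ A B → A * A - (A - A) * (A - B) ≡ A * A
    height = solve 2 (λ A B → A :* A :- (A :- A) :* (A :- B) := A :* A) refl

  chord-endpoint : ∀ A B → chord A B B ≡ parabola B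
  chord-endpoint A B = cong (B ,_) (height A B)
    where
    height : ∀ A B → B * B - (B - A) * (B - B) ≡ B * B
    height = solve 2 (λ A B → B :* B :- (B :- A) :* (B :- B) := B :* B) refl

  chord-injective : ∀ {A B C D X Y} → chord A B X ≡ chord C D Y →
    X ≡ Y × (X - A) * (X - B) ≡ (X - C) * (X - D)
  chord-injective {A} {B} {C} {D} {X} e with cong proj₁ e
  ... | refl = refl , cancel (X * X) (cong proj₂ e)
    where
    cancel : ∀ Z {u v} → Z - u ≡ Z - v → u ≡ v
    cancel Z {u} {v} eq = begin
      u            ≡⟨ u≡Z-[Z-u] Z u ⟩
      Z - (Z - u)  ≡⟨ cong (λ w → Z - w) eq ⟩
      Z - (Z - v)  ≡⟨ sym (u≡Z-[Z-u] Z v) ⟩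
      v            ∎
      where
      open ≡-Reasoning
      u≡Z-[Z-u] : ∀ Z u → u ≡ Z - (Z - u)
      u≡Z-[Z-u] = solve 2 (λ Z u → u := Z :- (Z :- u)) refl

  data ChordsMeet (A B C D X : ℚ) : Set where
    crossing    : Interleaved _<_ A B C D → ChordsMeet A B C D X
    at-start    : X ≡ A → A ≡ C ⊎ A ≡ D → ChordsMeet A B C D X
    at-end      : X ≡ B → B ≡ C ⊎ B ≡ D → ChordsMeet A B C D X
    same-chord  : (A ≡ C × B ≡ D) ⊎ (A ≡ D × B ≡ C) → ChordsMeet A B C D X

  ChordsMeet-swapˡ : ∀ {A B C D X} → ChordsMeet A B C D X → ChordsMeet B A C D X
  ChordsMeet-swapˡ (crossing i) = crossing (Interleaved-swapˡ i)
  ChordsMeet-swapˡ (at-start X≡A A∈CD) = at-end X≡A A∈CD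
  ChordsMeet-swapˡ (at-end X≡B B∈CD) = at-start X≡B B∈CD
  ChordsMeet-swapˡ (same-chord (inj₁ (A≡C , B≡D))) = same-chord (inj₂ (B≡D , A≡C))
  ChordsMeet-swapˡ (same-chord (inj₂ (A≡D , B≡C))) = same-chord (inj₁ (B≡C , A≡D))

  ChordsMeet-sym : ∀ {A B C D X} → ChordsMeet A B C D X → ChordsMeet C D A B X
  ChordsMeet-sym (crossing i) = crossing (Interleaved-sym i)
  ChordsMeet-sym (at-start X≡A (inj₁ A≡C)) = at-start (trans X≡A A≡C) (inj₁ (sym A≡C))
  ChordsMeet-sym (at-start X≡A (inj₂ A≡D)) = at-end (trans X≡A A≡D) (inj₁ (sym A≡D))
  ChordsMeet-sym (at-end X≡B (inj₁ B≡C)) = at-start (trans X≡B B≡C) (inj₂ (sym B≡C))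
  ChordsMeet-sym (at-end X≡B (inj₂ B≡D)) = at-end (trans X≡B B≡D) (inj₂ (sym B≡D))
  ChordsMeet-sym (same-chord (inj₁ (A≡C , B≡D))) = same-chord (inj₁ (sym A≡C , sym B≡D))
  ChordsMeet-sym (same-chord (inj₂ (A≡D , B≡C))) = same-chord (inj₂ (sym B≡C , sym A≡D))

  ChordsMeet-swapʳ : ∀ {A B C D X} → ChordsMeet A B C D X → ChordsMeet A B D C X
  ChordsMeet-swapʳ = ChordsMeet-sym ∘ ChordsMeet-swapˡ ∘ ChordsMeet-sym

  -- With the nonnegative gaps p = X - C, q = D - X, α = C - A, β = B - D the
  -- equation of the two chords reads p β + α q + α β = 0, so all three terms vanish.
  nested-chords-meet : ∀ {A B C D X} → A ≤ C → C ≤ X → X ≤ D → D ≤ B →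
    (X - A) * (X - B) ≡ (X - C) * (X - D) → ChordsMeet A B C D X
  nested-chords-meet {A} {B} {C} {D} {X} A≤C C≤X X≤D D≤B eq = meet (p*q≡0⇒p≡0⊎q≡0 α β αβ≡0)
    where
    p q α β : ℚ
    p = X - C
    q = D - X
    α = C - A
    β = B - D
    0≤pβ : 0ℚ ≤ p * β
    0≤pβ = 0≤p*q (p≤q⇒0≤q-p C≤X) (p≤q⇒0≤q-p D≤B)
    0≤αq : 0ℚ ≤ α * q
    0≤αq = 0≤p*q (p≤q⇒0≤q-p A≤C) (p≤q⇒0≤q-p X≤D)
    0≤αβ : 0ℚ ≤ α * β
    0≤αβ = 0≤p*q (p≤q⇒0≤q-p A≤C) (p≤q⇒0≤q-p D≤B)
    sum≡0 : p * β + α * q + α * β ≡ 0ℚ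
    sum≡0 = begin
      p * β + α * q + α * β                  ≡⟨ gaps X A B C D ⟩
      (X - C) * (X - D) - (X - A) * (X - B)  ≡⟨ cong (λ w → (X - C) * (X - D) - w) eq ⟩
      (X - C) * (X - D) - (X - C) * (X - D)  ≡⟨ +-inverseʳ ((X - C) * (X - D)) ⟩
      0ℚ                                     ∎
      where
      open ≡-Reasoning
      gaps : ∀ X A B C D → (X - C) * (B - D) + (C - A) * (D - X) + (C - A) * (B - D) ≡
                           (X - C) * (X - D) - (X - A) * (X - B)
      gaps = solve 5 (λ X A B C D → (X :- C) :* (B :- D) :+ (C :- A) :* (D :- X) :+ (C :- A) :* (B :- D) :=
                              (X :- C) :* (X :- D) :- (X :- A) :* (X :- B)) refl
    pβ+αq≡0 : p * β + α * q ≡ 0ℚ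
    pβ+αq≡0 = p+q≡0⇒p≡0 (0≤p+q 0≤pβ 0≤αq) 0≤αβ sum≡0
    αβ≡0 : α * β ≡ 0ℚ
    αβ≡0 = p+q≡0⇒q≡0 (0≤p+q 0≤pβ 0≤αq) 0≤αβ sum≡0
    pβ≡0 : p * β ≡ 0ℚ
    pβ≡0 = p+q≡0⇒p≡0 0≤pβ 0≤αq pβ+αq≡0
    αq≡0 : α * q ≡ 0ℚ
    αq≡0 = p+q≡0⇒q≡0 0≤pβ 0≤αq pβ+αq≡0
    meet-at-start : α ≡ 0ℚ → p ≡ 0ℚ ⊎ β ≡ 0ℚ → ChordsMeet A B C D X
    meet-at-start α≡0 (inj₁ p≡0) = at-start (trans (p-q≡0⇒p≡q p≡0) C≡A) (inj₁ (sym C≡A))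
      where
      C≡A : C ≡ A
      C≡A = p-q≡0⇒p≡q α≡0
    meet-at-start α≡0 (inj₂ β≡0) = same-chord (inj₁ (sym (p-q≡0⇒p≡q α≡0) , p-q≡0⇒p≡q β≡0))
    meet-at-end : β ≡ 0ℚ → α ≡ 0ℚ ⊎ q ≡ 0ℚ → ChordsMeet A B C D X
    meet-at-end β≡0 (inj₁ α≡0) = same-chord (inj₁ (sym (p-q≡0⇒p≡q α≡0) , p-q≡0⇒p≡q β≡0))
    meet-at-end β≡0 (inj₂ q≡0) = at-end (trans (sym (p-q≡0⇒p≡q q≡0)) D≡B) (inj₂ (sym D≡B))
      where
      D≡B : D ≡ B
      D≡B = sym (p-q≡0⇒p≡q β≡0)
    meet : α ≡ 0ℚ ⊎ β ≡ 0ℚ → ChordsMeet A B C D X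
    meet (inj₁ α≡0) = meet-at-start α≡0 (p*q≡0⇒p≡0⊎q≡0 p β pβ≡0)
    meet (inj₂ β≡0) = meet-at-end β≡0 (p*q≡0⇒p≡0⊎q≡0 α q αq≡0)

  ordered-chords-meet : ∀ {A B C D X} → A ≤ C → A ≤ X → X ≤ B → C ≤ X → X ≤ D →
    (X - A) * (X - B) ≡ (X - C) * (X - D) → ChordsMeet A B C D X
  ordered-chords-meet {A} {B} {C} {D} {X} A≤C A≤X X≤B C≤X X≤D eq with <-cmp B C
  ... | tri< B<C _ _ = ⊥-elim (<-irrefl refl (≤-<-trans X≤B (<-≤-trans B<C C≤X)))
  ... | tri≈ _ B≡C _ = at-end (≤-antisym X≤B (subst (_≤ X) (sym B≡C) C≤X)) (inj₁ B≡C)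
  ... | tri> _ _ C<B with <-cmp B D
  ...   | tri≈ _ B≡D _ = nested-chords-meet A≤C C≤X X≤D (≤-reflexive (sym B≡D)) eq
  ...   | tri> _ _ D<B = nested-chords-meet A≤C C≤X X≤D (<⇒≤ D<B) eq
  ...   | tri< B<D _ _ with <-cmp A C
  ...     | tri< A<C _ _ = crossing (acbd A<C C<B B<D)
  ...     | tri≈ _ A≡C _ =
            ChordsMeet-sym (nested-chords-meet (≤-reflexive (sym A≡C)) A≤X X≤B (<⇒≤ B<D) (sym eq))
  ...     | tri> _ _ C<A = ⊥-elim (<-irrefl refl (<-≤-trans C<A A≤C))

  private
    chords-meet-<< : ∀ {A B C D X} → A < B → C < D → Between A B X → Between C D X →
      (X - A) * (X - B) ≡ (X - C) * (X - D) → ChordsMeet A B C D X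
    chords-meet-<< {A} {B} {C} {D} A<B C<D AB∋X CD∋X eq
      with Between-ordered A<B AB∋X | Between-ordered C<D CD∋X | ≤-total A C
    ... | A≤X , X≤B | C≤X , X≤D | inj₁ A≤C = ordered-chords-meet A≤C A≤X X≤B C≤X X≤D eq
    ... | A≤X , X≤B | C≤X , X≤D | inj₂ C≤A =
          ChordsMeet-sym (ordered-chords-meet C≤A C≤X X≤D A≤X X≤B (sym eq))

    chords-meet-< : ∀ {A B C D X} → A < B → C ≢ D → Between A B X → Between C D X →
      (X - A) * (X - B) ≡ (X - C) * (X - D) → ChordsMeet A B C D X
    chords-meet-< {A} {B} {C} {D} {X} A<B C≢D AB∋X CD∋X eq with <-cmp C D
    ... | tri< C<D _ _ = chords-meet-<< A<B C<D AB∋X CD∋X eq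
    ... | tri≈ _ C≡D _ = ⊥-elim (C≢D C≡D)
    ... | tri> _ _ D<C = ChordsMeet-swapʳ
          (chords-meet-<< A<B D<C AB∋X (Between-sym CD∋X) (trans eq (*-comm (X - C) (X - D))))

  chords-meet : ∀ {A B C D X} → A ≢ B → C ≢ D → Between A B X → Between C D X →
    (X - A) * (X - B) ≡ (X - C) * (X - D) → ChordsMeet A B C D X
  chords-meet {A} {B} {C} {D} {X} A≢B C≢D AB∋X CD∋X eq with <-cmp A B
  ... | tri< A<B _ _ = chords-meet-< A<B C≢D AB∋X CD∋X eq
  ... | tri≈ _ A≡B _ = ⊥-elim (A≢B A≡B)
  ... | tri> _ _ B<A = ChordsMeet-swapˡ
        (chords-meet-< B<A C≢D (Between-sym AB∋X) CD∋X (trans (*-comm (X - B) (X - A)) eq))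

  parabola-off-chords : ∀ {A B V} → V ≢ A → V ≢ B → ¬ OnSegment (parabola V) (parabola A) (parabola B)
  parabola-off-chords {A} {B} {V} V≢A V≢B (s , _ , on) =
    [ V≢A ∘ p-q≡0⇒p≡q , V≢B ∘ p-q≡0⇒p≡q ]′ (p*q≡0⇒p≡0⊎q≡0 (V - A) (V - B) product≡0)
    where
    same-point : chord V V V ≡ chord A B (A + s * (B - A))
    same-point = trans (chord-startpoint V V) (trans on (lerp-parabola A B s))
    product≡0 : (V - A) * (V - B) ≡ 0ℚ
    product≡0 = trans (sym (proj₂ (chord-injective same-point))) (zero-height V)
      where
      zero-height : ∀ V → (V - V) * (V - V) ≡ 0ℚ
      zero-height = solve 1 (λ V → (V :- V) :* (V :- V) := con 0ℚ) refl

  fromℕ : ℕ → ℚ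
  fromℕ zero    = 0ℚ
  fromℕ (suc n) = 1ℚ + fromℕ n

  fromℕ-<-suc : ∀ n → fromℕ n < fromℕ (suc n)
  fromℕ-<-suc n = subst (_< fromℕ (suc n)) (+-identityˡ (fromℕ n)) (+-monoˡ-< (fromℕ n) (positive⁻¹ 1ℚ))

  fromℕ-mono-≤ : ∀ {m n} → m ℕ.≤ n → fromℕ m ≤ fromℕ n
  fromℕ-mono-≤ {n = zero}  ℕ.z≤n      = ≤-refl
  fromℕ-mono-≤ {n = suc n} ℕ.z≤n      = ≤-trans (fromℕ-mono-≤ {n = n} ℕ.z≤n) (<⇒≤ (fromℕ-<-suc n))
  fromℕ-mono-≤             (ℕ.s≤s m≤n) = +-monoʳ-≤ 1ℚ (fromℕ-mono-≤ m≤n)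

  fromℕ-mono-< : ∀ {m n} → m ℕ.< n → fromℕ m < fromℕ n
  fromℕ-mono-< {m} m<n = <-≤-trans (fromℕ-<-suc m) (fromℕ-mono-≤ m<n)

  fromℕ-cancel-< : ∀ {m n} → fromℕ m < fromℕ n → m ℕ.< n
  fromℕ-cancel-< {m} {n} fm<fn with ℕ.<-cmp m n
  ... | tri< m<n _ _ = m<n
  ... | tri≈ _ refl _ = ⊥-elim (<-irrefl refl fm<fn)
  ... | tri> _ _ n<m = ⊥-elim (<-asym fm<fn (fromℕ-mono-< n<m))

  fromℕ-injective : ∀ {m n} → fromℕ m ≡ fromℕ n → m ≡ n
  fromℕ-injective {m} {n} fm≡fn with ℕ.<-cmp m n
  ... | tri< m<n _ _ = ⊥-elim (<-irrefl fm≡fn (fromℕ-mono-< m<n))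
  ... | tri≈ _ m≡n _ = m≡n
  ... | tri> _ _ n<m = ⊥-elim (<-irrefl (sym fm≡fn) (fromℕ-mono-< n<m))

  sumℚ-nonNeg : ∀ {m} (f : Fin m → ℚ) → (∀ j → 0ℚ ≤ f j) → 0ℚ ≤ sumℚ f
  sumℚ-nonNeg {zero}  f 0≤f = ≤-refl
  sumℚ-nonNeg {suc m} f 0≤f = 0≤p+q (0≤f Fin.zero) (sumℚ-nonNeg (f ∘ Fin.suc) (0≤f ∘ Fin.suc))

  sumℚ≡0⇒≡0 : ∀ {m} (f : Fin m → ℚ) → (∀ j → 0ℚ ≤ f j) → sumℚ f ≡ 0ℚ → ∀ j → f j ≡ 0ℚ
  sumℚ≡0⇒≡0 {suc m} f 0≤f Σf≡0 Fin.zero =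
    p+q≡0⇒p≡0 (0≤f Fin.zero) (sumℚ-nonNeg (f ∘ Fin.suc) (0≤f ∘ Fin.suc)) Σf≡0
  sumℚ≡0⇒≡0 {suc m} f 0≤f Σf≡0 (Fin.suc j) =
    sumℚ≡0⇒≡0 (f ∘ Fin.suc) (0≤f ∘ Fin.suc)
      (p+q≡0⇒q≡0 (0≤f Fin.zero) (sumℚ-nonNeg (f ∘ Fin.suc) (0≤f ∘ Fin.suc)) Σf≡0) j

  sumℚ-zero : ∀ {m} (f : Fin m → ℚ) → (∀ j → f j ≡ 0ℚ) → sumℚ f ≡ 0ℚ
  sumℚ-zero {zero}  f f≡0 = refl
  sumℚ-zero {suc m} f f≡0 =
    trans (cong₂ _+_ (f≡0 Fin.zero) (sumℚ-zero (f ∘ Fin.suc) (f≡0 ∘ Fin.suc))) (+-identityʳ 0ℚ)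

  sumℚ-weighted-square : ∀ {m} (w x : Fin m → ℚ) c →
    sumℚ (λ j → w j * ((x j - c) * (x j - c))) ≡
    sumℚ (λ j → w j * (x j * x j)) - (c + c) * sumℚ (λ j → w j * x j) + c * c * sumℚ w
  sumℚ-weighted-square {zero} w x c = empty c
    where
    empty : ∀ c → 0ℚ ≡ 0ℚ - (c + c) * 0ℚ + c * c * 0ℚ
    empty = solve 1 (λ c → con 0ℚ := con 0ℚ :- (c :+ c) :* con 0ℚ :+ c :* c :* con 0ℚ) refl
  sumℚ-weighted-square {suc m} w x c = begin
    w₀ * ((x₀ - c) * (x₀ - c)) + sumℚ (λ j → w (Fin.suc j) * ((x (Fin.suc j) - c) * (x (Fin.suc j) - c)))
      ≡⟨ cong (w₀ * ((x₀ - c) * (x₀ - c)) +_) (sumℚ-weighted-square (w ∘ Fin.suc) (x ∘ Fin.suc) c) ⟩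
    w₀ * ((x₀ - c) * (x₀ - c)) + (Σwx² - (c + c) * Σwx + c * c * Σw)
      ≡⟨ expand w₀ x₀ c Σwx² Σwx Σw ⟩
    (w₀ * (x₀ * x₀) + Σwx²) - (c + c) * (w₀ * x₀ + Σwx) + c * c * (w₀ + Σw) ∎
    where
    open ≡-Reasoning
    w₀ x₀ Σwx² Σwx Σw : ℚ
    w₀ = w Fin.zero
    x₀ = x Fin.zero
    Σwx² = sumℚ (λ j → w (Fin.suc j) * (x (Fin.suc j) * x (Fin.suc j)))
    Σwx = sumℚ (λ j → w (Fin.suc j) * x (Fin.suc j))
    Σw = sumℚ (w ∘ Fin.suc)
    expand : ∀ w₀ x₀ c Σwx² Σwx Σw →
      w₀ * ((x₀ - c) * (x₀ - c)) + (Σwx² - (c + c) * Σwx + c * c * Σw) ≡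
      (w₀ * (x₀ * x₀) + Σwx²) - (c + c) * (w₀ * x₀ + Σwx) + c * c * (w₀ + Σw)
    expand = solve 6 (λ w₀ x₀ c Σwx² Σwx Σw →
      w₀ :* ((x₀ :- c) :* (x₀ :- c)) :+ (Σwx² :- (c :+ c) :* Σwx :+ c :* c :* Σw) :=
      (w₀ :* (x₀ :* x₀) :+ Σwx²) :- (c :+ c) :* (w₀ :* x₀ :+ Σwx) :+ c :* c :* (w₀ :+ Σw)) refl

  -- The hull equations make Σ w j (x j - x i)² vanish, so all weight would sit on
  -- the point x i itself, whose weight is 0.
  parabola-convex : ∀ {m} (x : Fin m → ℚ) → (∀ i j → x i ≡ x j → i ≡ j) →
    ∀ i → ¬ InHullOfOthers (parabola ∘ x) i
  parabola-convex x x-injective i (w , 0≤w , wᵢ≡0 , Σw≡1 , Σwx≡xᵢ , Σwx²≡xᵢ²) =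
    1≢0 (trans (sym Σw≡1) (sumℚ-zero w w≡0))
    where
    spread : Fin _ → ℚ
    spread j = w j * ((x j - x i) * (x j - x i))
    Σspread≡0 : sumℚ spread ≡ 0ℚ
    Σspread≡0 = begin
      sumℚ spread
        ≡⟨ sumℚ-weighted-square w x (x i) ⟩
      sumℚ (λ j → w j * (x j * x j)) - (x i + x i) * sumℚ (λ j → w j * x j) + x i * x i * sumℚ w
        ≡⟨ cong₂ (λ a b → a - (x i + x i) * b + x i * x i * sumℚ w) Σwx²≡xᵢ² Σwx≡xᵢ ⟩
      x i * x i - (x i + x i) * x i + x i * x i * sumℚ w
        ≡⟨ cong (λ b → x i * x i - (x i + x i) * x i + x i * x i * b) Σw≡1 ⟩
      x i * x i - (x i + x i) * x i + x i * x i * 1ℚ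
        ≡⟨ no-spread (x i) ⟩
      0ℚ ∎
      where
      open ≡-Reasoning
      no-spread : ∀ c → c * c - (c + c) * c + c * c * 1ℚ ≡ 0ℚ
      no-spread = solve 1 (λ c → c :* c :- (c :+ c) :* c :+ c :* c :* con 1ℚ := con 0ℚ) refl
    w≡0′ : ∀ j → w j ≡ 0ℚ ⊎ (x j - x i) * (x j - x i) ≡ 0ℚ → w j ≡ 0ℚ
    w≡0′ j (inj₁ wⱼ≡0) = wⱼ≡0
    w≡0′ j (inj₂ square≡0) =
      subst (λ j → w j ≡ 0ℚ) (x-injective i j (sym (p-q≡0⇒p≡q (square≡0⇒≡0 square≡0)))) wᵢ≡0
      where
      square≡0⇒≡0 : ∀ {p} → p * p ≡ 0ℚ → p ≡ 0ℚ
      square≡0⇒≡0 {p} pp≡0 = [ id , id ]′ (p*q≡0⇒p≡0⊎q≡0 p p pp≡0)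
    w≡0 : ∀ j → w j ≡ 0ℚ
    w≡0 j = w≡0′ j (p*q≡0⇒p≡0⊎q≡0 (w j) _
      (sumℚ≡0⇒≡0 spread (λ j → 0≤p*q (0≤w j) (0≤p*p (x j - x i))) Σspread≡0 j))

  module ParabolaDrawing (G : Graph) (x : Fin (n G) → ℚ) (x-injective : ∀ i j → x i ≡ x j → i ≡ j) where

    drawing : Drawing G
    drawing = record
      { pos       = parabola ∘ x
      ; posInj    = λ i j → x-injective i j ∘ cong proj₁
      ; noThrough = λ i j v _ v≢i v≢j →
          parabola-off-chords (v≢i ∘ x-injective v i) (v≢j ∘ x-injective v j)
      }

    convex : ConvexPosition drawing
    convex = parabola-convex x x-injective

    cross⇒interleaved : ∀ {i j k l} → i ≢ j → k ≢ l → ¬ SameEdge i j k l → Cross drawing i j k l →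
      Interleaved _<_ (x i) (x j) (x k) (x l)
    cross⇒interleaved {i} {j} {k} {l} i≢j k≢l ¬same (s , t , s∈I , t∈I , same-lerp , off-ends) =
      crossing-of (chords-meet (i≢j ∘ x-injective i j) (k≢l ∘ x-injective k l)
        (lerp-between (x i) (x j) s∈I) (subst (Between (x k) (x l)) (sym X≡Y) (lerp-between (x k) (x l) t∈I))
        heights)
      where
      X Y : ℚ
      X = x i + s * (x j - x i)
      Y = x k + t * (x l - x k)
      same-point : chord (x i) (x j) X ≡ chord (x k) (x l) Y
      same-point = trans (sym (lerp-parabola (x i) (x j) s)) (trans same-lerp (lerp-parabola (x k) (x l) t))
      X≡Y : X ≡ Y
      X≡Y = proj₁ (chord-injective same-point)
      heights : (X - x i) * (X - x j) ≡ (X - x k) * (X - x l)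
      heights = proj₂ (chord-injective same-point)
      meets-at-start : X ≡ x i → lerp (parabola (x i)) (parabola (x j)) s ≡ parabola (x i)
      meets-at-start X≡xᵢ = trans (lerp-parabola (x i) (x j) s)
        (trans (cong (chord (x i) (x j)) X≡xᵢ) (chord-startpoint (x i) (x j)))
      meets-at-end : X ≡ x j → lerp (parabola (x i)) (parabola (x j)) s ≡ parabola (x j)
      meets-at-end X≡xⱼ = trans (lerp-parabola (x i) (x j) s)
        (trans (cong (chord (x i) (x j)) X≡xⱼ) (chord-endpoint (x i) (x j)))
      crossing-of : ChordsMeet (x i) (x j) (x k) (x l) X → Interleaved _<_ (x i) (x j) (x k) (x l)
      crossing-of (crossing c) = c
      crossing-of (at-start X≡xᵢ (inj₁ xᵢ≡xₖ)) =
        ⊥-elim (off-ends i (inj₁ refl) (inj₁ (x-injective i k xᵢ≡xₖ)) (meets-at-start X≡xᵢ))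
      crossing-of (at-start X≡xᵢ (inj₂ xᵢ≡xₗ)) =
        ⊥-elim (off-ends i (inj₁ refl) (inj₂ (x-injective i l xᵢ≡xₗ)) (meets-at-start X≡xᵢ))
      crossing-of (at-end X≡xⱼ (inj₁ xⱼ≡xₖ)) =
        ⊥-elim (off-ends j (inj₂ refl) (inj₁ (x-injective j k xⱼ≡xₖ)) (meets-at-end X≡xⱼ))
      crossing-of (at-end X≡xⱼ (inj₂ xⱼ≡xₗ)) =
        ⊥-elim (off-ends j (inj₂ refl) (inj₂ (x-injective j l xⱼ≡xₗ)) (meets-at-end X≡xⱼ))
      crossing-of (same-chord (inj₁ (xᵢ≡xₖ , xⱼ≡xₗ))) =
        ⊥-elim (¬same (inj₁ (x-injective i k xᵢ≡xₖ , x-injective j l xⱼ≡xₗ)))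
      crossing-of (same-chord (inj₂ (xᵢ≡xₗ , xⱼ≡xₖ))) =
        ⊥-elim (¬same (inj₂ (x-injective i l xᵢ≡xₗ , x-injective j k xⱼ≡xₖ)))

open Parabola using (fromℕ; fromℕ-injective; fromℕ-cancel-<; module ParabolaDrawing)

module StarLayouts where
  open import Data.Nat using (_<_; _≤_; _*_)
  open import Data.Vec.Functional using (insertAt)
  open import Data.Vec.Functional.Properties using (insertAt-lookup; insertAt-punchIn)

  -- rank is the position of a vertex on the convex curve of the drawing, stage the time at
  -- which it was added to the k-tree.
  record StarLayout (k m : ℕ) (a : Fin m → Fin m → Bool) : Set where
    field
      rank                     : Fin m → ℕ
      rank-injective           : ∀ x y → rank x ≡ rank y → x ≡ y
      stage                    : Fin m → ℕ
      stage<m                  : ∀ x → stage x < m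
      stage-injective          : ∀ x y → stage x ≡ stage y → x ≡ y
      colour                   : Fin m → Fin m → Fin (suc k)
      colour-sym               : ∀ x y → colour x y ≡ colour y x
      older-colours-distinct   : ∀ x y z → a x y ≡ true → stage y < stage x →
                                 a x z ≡ true → stage z < stage x → colour x y ≡ colour x z → y ≡ z
      no-monochromatic-descent : ∀ x y z → a x y ≡ true → stage y < stage x →
                                 a y z ≡ true → stage z < stage y → colour x y ≢ colour y z
      free-colour              : ∀ x → ∃ λ α → ∀ y → a x y ≡ true → stage y < stage x → colour x y ≢ α
      non-crossing             : ∀ x y z t → a x y ≡ true → a z t ≡ true → colour x y ≡ colour z t →
                                 ¬ Interleaved _<_ (rank x) (rank y) (rank z) (rank t)

  punchIn-cases : ∀ {m} (v : Fin (suc m)) (P : Fin (suc m) → Set) →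
    P v → (∀ i → P (punchIn v i)) → ∀ x → P x
  punchIn-cases v P Pv Pι x with x Fin.≟ v
  ... | yes refl = Pv
  ... | no x≢v = subst P (Fin.punchIn-punchOut (x≢v ∘ sym)) (Pι (punchOut (x≢v ∘ sym)))

  true≢false : true ≢ false
  true≢false ()

  module Extension {k m : ℕ} (a : Fin (suc m) → Fin (suc m) → Bool) (v : Fin (suc m))
    (a-sym : ∀ x y → a x y ≡ a y x) (a-irrefl : ∀ x → a x x ≡ false)
    (L : StarLayout k m (λ i j → a (punchIn v i) (punchIn v j)))
    (rv : ℕ) (cv : Fin m → Fin (suc k))
    (rv-fresh : ∀ i → rv ≢ 2 * StarLayout.rank L i)
    (cv-injective : ∀ j l → a v (punchIn v j) ≡ true → a v (punchIn v l) ≡ true → cv j ≡ cv l → j ≡ l)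
    (cv-no-descent : ∀ j i → a v (punchIn v j) ≡ true → a (punchIn v j) (punchIn v i) ≡ true →
                     StarLayout.stage L i < StarLayout.stage L j → cv j ≢ StarLayout.colour L j i)
    (cv-free : ∃ λ α → ∀ j → a v (punchIn v j) ≡ true → cv j ≢ α)
    (cv-non-crossing : ∀ j l q → a v (punchIn v j) ≡ true → a (punchIn v l) (punchIn v q) ≡ true →
                       cv j ≡ StarLayout.colour L l q →
                       ¬ Interleaved _<_ rv (2 * StarLayout.rank L j) (2 * StarLayout.rank L l)
                                            (2 * StarLayout.rank L q))
    where
    open StarLayout L

    ι : Fin m → Fin (suc m)
    ι = punchIn v

    -- Doubling the old ranks leaves a free position next to every old vertex.
    rank⁺ : Fin (suc m) → ℕ
    rank⁺ = insertAt (λ i → 2 * rank i) v rv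

    stage⁺ : Fin (suc m) → ℕ
    stage⁺ = insertAt stage v m

    colour-row : Fin m → Fin (suc m) → Fin (suc k)
    colour-row i = insertAt (colour i) v (cv i)

    colour-rowᵥ : Fin (suc m) → Fin (suc k)
    colour-rowᵥ = insertAt cv v Fin.zero

    colour⁺ : Fin (suc m) → Fin (suc m) → Fin (suc k)
    colour⁺ = insertAt colour-row v colour-rowᵥ

    rank⁺-v : rank⁺ v ≡ rv
    rank⁺-v = insertAt-lookup _ v rv

    rank⁺-ι : ∀ i → rank⁺ (ι i) ≡ 2 * rank i
    rank⁺-ι = insertAt-punchIn _ v rv

    stage⁺-v : stage⁺ v ≡ m
    stage⁺-v = insertAt-lookup stage v m

    stage⁺-ι : ∀ i → stage⁺ (ι i) ≡ stage i
    stage⁺-ι = insertAt-punchIn stage v m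

    colour⁺-vι : ∀ j → colour⁺ v (ι j) ≡ cv j
    colour⁺-vι j = trans (cong-app (insertAt-lookup colour-row v colour-rowᵥ) (ι j)) (insertAt-punchIn cv v _ j)

    colour⁺-ιv : ∀ i → colour⁺ (ι i) v ≡ cv i
    colour⁺-ιv i = trans (cong-app (insertAt-punchIn colour-row v colour-rowᵥ i) v) (insertAt-lookup (colour i) v _)

    colour⁺-ιι : ∀ i j → colour⁺ (ι i) (ι j) ≡ colour i j
    colour⁺-ιι i j = trans (cong-app (insertAt-punchIn colour-row v colour-rowᵥ i) (ι j))
      (insertAt-punchIn (colour i) v _ j)

    ¬a-vv : a v v ≢ true
    ¬a-vv avv = true≢false (trans (sym avv) (a-irrefl v))

    v-youngest : ∀ i → ¬ stage⁺ v < stage⁺ (ι i)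
    v-youngest i v<i = ℕ.<-asym (subst₂ _<_ stage⁺-v (stage⁺-ι i) v<i) (stage<m i)

    older⁺ : ∀ {i j} → stage⁺ (ι j) < stage⁺ (ι i) → stage j < stage i
    older⁺ {i} {j} = subst₂ _<_ (stage⁺-ι j) (stage⁺-ι i)

    rank⁺-injective : ∀ x y → rank⁺ x ≡ rank⁺ y → x ≡ y
    rank⁺-injective = punchIn-cases v _
      (punchIn-cases v _ (λ _ → refl)
        (λ j e → ⊥-elim (rv-fresh j (trans (sym rank⁺-v) (trans e (rank⁺-ι j))))))
      (λ i → punchIn-cases v _
        (λ e → ⊥-elim (rv-fresh i (trans (sym rank⁺-v) (trans (sym e) (rank⁺-ι i)))))
        (λ j e → cong ι (rank-injective i j
          (ℕ.*-cancelˡ-≡ _ _ 2 (trans (sym (rank⁺-ι i)) (trans e (rank⁺-ι j)))))))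

    stage⁺<1+m : ∀ x → stage⁺ x < suc m
    stage⁺<1+m = punchIn-cases v _
      (subst (_< suc m) (sym stage⁺-v) (ℕ.n<1+n m))
      (λ i → subst (_< suc m) (sym (stage⁺-ι i)) (ℕ.<-trans (stage<m i) (ℕ.n<1+n m)))

    stage⁺-injective : ∀ x y → stage⁺ x ≡ stage⁺ y → x ≡ y
    stage⁺-injective = punchIn-cases v _
      (punchIn-cases v _ (λ _ → refl)
        (λ j e → ⊥-elim (ℕ.<-irrefl (trans (sym (stage⁺-ι j)) (trans (sym e) stage⁺-v)) (stage<m j))))
      (λ i → punchIn-cases v _
        (λ e → ⊥-elim (ℕ.<-irrefl (trans (sym (stage⁺-ι i)) (trans e stage⁺-v)) (stage<m i)))
        (λ j e → cong ι (stage-injective i j (trans (sym (stage⁺-ι i)) (trans e (stage⁺-ι j))))))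

    colour⁺-sym : ∀ x y → colour⁺ x y ≡ colour⁺ y x
    colour⁺-sym = punchIn-cases v _
      (punchIn-cases v _ refl (λ j → trans (colour⁺-vι j) (sym (colour⁺-ιv j))))
      (λ i → punchIn-cases v _ (trans (colour⁺-ιv i) (sym (colour⁺-vι i)))
        (λ j → trans (colour⁺-ιι i j) (trans (colour-sym i j) (sym (colour⁺-ιι j i)))))

    older-colours-distinct⁺ : ∀ x y z → a x y ≡ true → stage⁺ y < stage⁺ x →
      a x z ≡ true → stage⁺ z < stage⁺ x → colour⁺ x y ≡ colour⁺ x z → y ≡ z
    older-colours-distinct⁺ = punchIn-cases v _
      (punchIn-cases v _ (λ _ avv _ _ _ _ → ⊥-elim (¬a-vv avv))
        (λ j → punchIn-cases v _ (λ _ _ avv _ _ → ⊥-elim (¬a-vv avv))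
          (λ l avj _ avl _ e → cong ι (cv-injective j l avj avl
            (trans (sym (colour⁺-vι j)) (trans e (colour⁺-vι l)))))))
      (λ i → punchIn-cases v _ (λ _ _ v<i _ _ _ → ⊥-elim (v-youngest i v<i))
        (λ j → punchIn-cases v _ (λ _ _ _ v<i _ → ⊥-elim (v-youngest i v<i))
          (λ l aij j<i ail l<i e → cong ι (older-colours-distinct i j l aij (older⁺ j<i) ail (older⁺ l<i)
            (trans (sym (colour⁺-ιι i j)) (trans e (colour⁺-ιι i l)))))))

    no-monochromatic-descent⁺ : ∀ x y z → a x y ≡ true → stage⁺ y < stage⁺ x →
      a y z ≡ true → stage⁺ z < stage⁺ y → colour⁺ x y ≢ colour⁺ y z
    no-monochromatic-descent⁺ = punchIn-cases v _
      (punchIn-cases v _ (λ _ avv _ _ _ _ → ¬a-vv avv)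
        (λ j → punchIn-cases v _ (λ _ _ _ v<j _ → v-youngest j v<j)
          (λ i avj _ aji i<j e → cv-no-descent j i avj aji (older⁺ i<j)
            (trans (sym (colour⁺-vι j)) (trans e (colour⁺-ιι j i))))))
      (λ l → punchIn-cases v _ (λ _ _ v<l _ _ _ → v-youngest l v<l)
        (λ j → punchIn-cases v _ (λ _ _ _ v<j _ → v-youngest j v<j)
          (λ i alj j<l aji i<j e → no-monochromatic-descent l j i alj (older⁺ j<l) aji (older⁺ i<j)
            (trans (sym (colour⁺-ιι l j)) (trans e (colour⁺-ιι j i))))))

    free-colour⁺ : ∀ x → ∃ λ α → ∀ y → a x y ≡ true → stage⁺ y < stage⁺ x → colour⁺ x y ≢ α
    free-colour⁺ = punchIn-cases v _
      (proj₁ cv-free , punchIn-cases v _ (λ avv _ _ → ¬a-vv avv)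
        (λ j avj _ e → proj₂ cv-free j avj (trans (sym (colour⁺-vι j)) e)))
      (λ i → proj₁ (free-colour i) , punchIn-cases v _ (λ _ v<i _ → v-youngest i v<i)
        (λ j aij j<i e → proj₂ (free-colour i) j aij (older⁺ j<i) (trans (sym (colour⁺-ιι i j)) e)))

    NoCrossing : Fin (suc m) → Fin (suc m) → Fin (suc m) → Fin (suc m) → Set
    NoCrossing x y z t = a x y ≡ true → a z t ≡ true → colour⁺ x y ≡ colour⁺ z t →
      ¬ Interleaved _<_ (rank⁺ x) (rank⁺ y) (rank⁺ z) (rank⁺ t)

    NoCrossing-swapˡ : ∀ {x y z t} → NoCrossing x y z t → NoCrossing y x z t
    NoCrossing-swapˡ {x} {y} nc ayx azt e =
      nc (trans (a-sym x y) ayx) azt (trans (colour⁺-sym x y) e) ∘ Interleaved-swapˡ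

    NoCrossing-sym : ∀ {x y z t} → NoCrossing x y z t → NoCrossing z t x y
    NoCrossing-sym nc azt axy e = nc axy azt (sym e) ∘ Interleaved-sym

    no-crossing-at-v : ∀ y z t → NoCrossing v y z t
    no-crossing-at-v = punchIn-cases v _ (λ _ _ avv _ _ _ → ¬a-vv avv)
      (λ j → punchIn-cases v _ (λ _ _ _ _ c → proj₁ (Interleaved⇒distinct c) refl)
        (λ l → punchIn-cases v _ (λ _ _ _ c → proj₁ (proj₂ (Interleaved⇒distinct c)) refl)
          (λ q avj alq e c → cv-non-crossing j l q avj alq
            (trans (sym (colour⁺-vι j)) (trans e (colour⁺-ιι l q)))
            (Interleaved-cong rank⁺-v (rank⁺-ι j) (rank⁺-ι l) (rank⁺-ι q) c))))

    no-crossing-old : ∀ i j l q → NoCrossing (ι i) (ι j) (ι l) (ι q)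
    no-crossing-old i j l q aij alq e c = non-crossing i j l q aij alq
      (trans (sym (colour⁺-ιι i j)) (trans e (colour⁺-ιι l q)))
      (Interleaved-reflect (2 *_) (ℕ.*-cancelˡ-< 2 _ _)
        (Interleaved-cong (rank⁺-ι i) (rank⁺-ι j) (rank⁺-ι l) (rank⁺-ι q) c))

    non-crossing⁺ : ∀ x y z t → NoCrossing x y z t
    non-crossing⁺ = punchIn-cases v _ no-crossing-at-v
      (λ i → punchIn-cases v _ (λ z t → NoCrossing-swapˡ (no-crossing-at-v (ι i) z t))
        (λ j → punchIn-cases v _ (λ t → NoCrossing-sym (no-crossing-at-v t (ι i) (ι j)))
          (λ l → punchIn-cases v _ (NoCrossing-sym (NoCrossing-swapˡ (no-crossing-at-v (ι l) (ι i) (ι j))))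
            (no-crossing-old i j l))))

    layout : StarLayout k (suc m) a
    layout = record
      { rank                     = rank⁺
      ; rank-injective           = rank⁺-injective
      ; stage                    = stage⁺
      ; stage<m                  = stage⁺<1+m
      ; stage-injective          = stage⁺-injective
      ; colour                   = colour⁺
      ; colour-sym               = colour⁺-sym
      ; older-colours-distinct   = older-colours-distinct⁺
      ; no-monochromatic-descent = no-monochromatic-descent⁺
      ; free-colour              = free-colour⁺
      ; non-crossing             = non-crossing⁺
      }

  layout-on-1+k-vertices : ∀ {k} (a : Fin (suc k) → Fin (suc k) → Bool) → StarLayout k (suc k) a
  layout-on-1+k-vertices {k} a = record
    { rank                     = Fin.toℕ
    ; rank-injective           = λ _ _ → Fin.toℕ-injective
    ; stage                    = Fin.toℕ
    ; stage<m                  = Fin.toℕ<n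
    ; stage-injective          = λ _ _ → Fin.toℕ-injective
    ; colour                   = _⊓_
    ; colour-sym               = ⊓-comm
    ; older-colours-distinct   = λ x y z _ y<x _ z<x e →
        trans (sym (older-endpoint y<x)) (trans e (older-endpoint z<x))
    ; no-monochromatic-descent = λ x y z _ y<x _ z<y e →
        ℕ.<-irrefl (cong Fin.toℕ (trans (sym (older-endpoint z<y)) (trans (sym e) (older-endpoint y<x)))) z<y
    ; free-colour              = λ x → x , λ y _ y<x e →
        ℕ.<-irrefl (cong Fin.toℕ (trans (sym (older-endpoint y<x)) e)) y<x
    ; non-crossing             = λ x y z t _ _ → no-crossing x y z t
    }
    where
    open import Algebra.Construct.NaturalChoice.Min (Fin.≤-totalOrder (suc k))
      using (_⊓_; ⊓-comm; ⊓-sel; x≤y⇒y⊓x≈x)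

    older-endpoint : ∀ {x y} → y Fin.< x → x ⊓ y ≡ y
    older-endpoint y<x = x≤y⇒y⊓x≈x (ℕ.<⇒≤ y<x)

    no-crossing : ∀ x y z t → x ⊓ y ≡ z ⊓ t →
      ¬ Interleaved _<_ (Fin.toℕ x) (Fin.toℕ y) (Fin.toℕ z) (Fin.toℕ t)
    no-crossing x y z t e c with ⊓-sel x y | ⊓-sel z t | Interleaved⇒distinct c
    ... | inj₁ x⊓y≡x | inj₁ z⊓t≡z | x≢z , _ = x≢z (cong Fin.toℕ (trans (sym x⊓y≡x) (trans e z⊓t≡z)))
    ... | inj₁ x⊓y≡x | inj₂ z⊓t≡t | _ , x≢t , _ = x≢t (cong Fin.toℕ (trans (sym x⊓y≡x) (trans e z⊓t≡t)))
    ... | inj₂ x⊓y≡y | inj₁ z⊓t≡z | _ , _ , y≢z , _ = y≢z (cong Fin.toℕ (trans (sym x⊓y≡y) (trans e z⊓t≡z)))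
    ... | inj₂ x⊓y≡y | inj₂ z⊓t≡t | _ , _ , _ , y≢t = y≢t (cong Fin.toℕ (trans (sym x⊓y≡y) (trans e z⊓t≡t)))

  extend-by-isolated : ∀ {k m} (a : Fin (suc m) → Fin (suc m) → Bool) (v : Fin (suc m)) →
    (∀ x y → a x y ≡ a y x) → (∀ x → a x x ≡ false) → (∀ u → a v (punchIn v u) ≢ true) →
    StarLayout k m (λ i j → a (punchIn v i) (punchIn v j)) → StarLayout k (suc m) a
  extend-by-isolated a v a-sym a-irrefl isolated L = Extension.layout a v a-sym a-irrefl L
    1 (λ _ → Fin.zero) (λ i → ℕ.even≢odd (StarLayout.rank L i) 0 ∘ sym)
    (λ j _ avj _ _ → ⊥-elim (isolated j avj)) (λ j _ avj _ _ _ → isolated j avj)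
    (Fin.zero , λ j avj _ → isolated j avj) (λ j _ _ avj _ _ _ → isolated j avj)

  argmax : ∀ {n} (g : Fin (suc n) → ℕ) → ∃ λ x → ∀ y → g y ≤ g x
  argmax {zero}  g = Fin.zero , λ { Fin.zero → ℕ.≤-refl }
  argmax {suc n} g with argmax (g ∘ Fin.suc)
  ... | x , max with g Fin.zero ℕ.≤? g (Fin.suc x)
  ...   | yes g₀≤ = Fin.suc x , λ { Fin.zero → g₀≤ ; (Fin.suc y) → max y }
  ...   | no g₀≰ = Fin.zero , λ { Fin.zero → ℕ.≤-refl ; (Fin.suc y) → ℕ.≤-trans (max y) (ℕ.<⇒≤ (ℕ.≰⇒> g₀≰)) }

  missing-value : ∀ {k} (g : Fin k → Fin (suc k)) → ∃ λ α → ∀ x → g x ≢ α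
  missing-value {k} g
    with Fin.¬∀⟶∃¬ (suc k) (λ α → ∃ λ x → g x ≡ α) (λ α → Fin.any? (λ x → g x Fin.≟ α)) ¬surjective
    where
    ¬surjective : ¬ (∀ α → ∃ λ x → g x ≡ α)
    ¬surjective preimage = ℕ.1+n≰n (Fin.injective⇒≤ λ {α} {β} e →
      trans (sym (proj₂ (preimage α))) (trans (cong g e) (proj₂ (preimage β))))
  ... | α , unhit = α , λ x gx≡α → unhit (x , gx≡α)

  module AttachToClique {k m : ℕ} (a : Fin (suc m) → Fin (suc m) → Bool) (v : Fin (suc m))
    (a-sym : ∀ x y → a x y ≡ a y x) (a-irrefl : ∀ x → a x x ≡ false)
    (f : Fin (suc k) → Fin m)
    (neighbours⊆clique : ∀ u → a v (punchIn v u) ≡ true → ∃ λ x → f x ≡ u)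
    (clique : ∀ x y → x ≢ y → a (punchIn v (f x)) (punchIn v (f y)) ≡ true)
    (L : StarLayout (suc k) m (λ i j → a (punchIn v i) (punchIn v j)))
    where
    open StarLayout L

    ι : Fin m → Fin (suc m)
    ι = punchIn v

    youngest : Fin (suc k)
    youngest = proj₁ (argmax (stage ∘ f))

    w : Fin m
    w = f youngest

    free-at-w : Fin (suc (suc k))
    free-at-w = proj₁ (free-colour w)

    cv : Fin m → Fin (suc (suc k))
    cv j with j Fin.≟ w
    ... | yes _ = free-at-w
    ... | no _  = colour w j

    cv-w : ∀ {j} → j ≡ w → cv j ≡ free-at-w
    cv-w {j} j≡w with j Fin.≟ w
    ... | yes _ = refl
    ... | no j≢w = ⊥-elim (j≢w j≡w)

    cv-other : ∀ {j} → j ≢ w → cv j ≡ colour w j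
    cv-other {j} j≢w with j Fin.≟ w
    ... | yes j≡w = ⊥-elim (j≢w j≡w)
    ... | no _ = refl

    older-neighbour-of-w : ∀ {j} → a v (ι j) ≡ true → j ≢ w → a (ι w) (ι j) ≡ true × stage j < stage w
    older-neighbour-of-w {j} avj j≢w with neighbours⊆clique j avj
    ... | x , refl = clique youngest x (j≢w ∘ cong f ∘ sym) ,
                     ℕ.≤∧≢⇒< (proj₂ (argmax (stage ∘ f)) x) (j≢w ∘ stage-injective _ _)

    colour-at-w-injective : ∀ {j q} → j ≢ w → a v (ι j) ≡ true → a (ι w) (ι q) ≡ true →
      colour w j ≡ colour w q → j ≡ q
    colour-at-w-injective {j} {q} j≢w avj awq e with ℕ.<-cmp (stage q) (stage w)
    ... | tri< q<w _ _ = let (awj , j<w) = older-neighbour-of-w avj j≢w in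
      older-colours-distinct w j q awj j<w awq q<w e
    ... | tri≈ _ q≡w _ rewrite stage-injective q w q≡w = ⊥-elim (true≢false (trans (sym awq) (a-irrefl (ι w))))
    ... | tri> _ _ w<q = let (awj , j<w) = older-neighbour-of-w avj j≢w in
      ⊥-elim (no-monochromatic-descent q w j (trans (a-sym (ι q) (ι w)) awq) w<q awj j<w
        (trans (colour-sym q w) (sym e)))

    cv-injective : ∀ j l → a v (ι j) ≡ true → a v (ι l) ≡ true → cv j ≡ cv l → j ≡ l
    cv-injective j l avj avl e = cases (j Fin.≟ w) (l Fin.≟ w)
      where
      cases : Dec (j ≡ w) → Dec (l ≡ w) → j ≡ l
      cases (yes j≡w) (yes l≡w) = trans j≡w (sym l≡w)
      cases (yes j≡w) (no l≢w)  = let (awl , l<w) = older-neighbour-of-w avl l≢w in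
        ⊥-elim (proj₂ (free-colour w) l awl l<w (trans (sym (cv-other l≢w)) (trans (sym e) (cv-w j≡w))))
      cases (no j≢w)  (yes l≡w) = let (awj , j<w) = older-neighbour-of-w avj j≢w in
        ⊥-elim (proj₂ (free-colour w) j awj j<w (trans (sym (cv-other j≢w)) (trans e (cv-w l≡w))))
      cases (no j≢w)  (no l≢w)  = colour-at-w-injective j≢w avj (proj₁ (older-neighbour-of-w avl l≢w))
        (trans (sym (cv-other j≢w)) (trans e (cv-other l≢w)))

    cv-no-descent : ∀ j i → a v (ι j) ≡ true → a (ι j) (ι i) ≡ true → stage i < stage j → cv j ≢ colour j i
    cv-no-descent j i avj aji i<j e = cases (j Fin.≟ w)
      where
      cases : Dec (j ≡ w) → ⊥
      cases (yes refl) = proj₂ (free-colour w) i aji i<j (trans (sym e) (cv-w refl))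
      cases (no j≢w) = let (awj , j<w) = older-neighbour-of-w avj j≢w in
        no-monochromatic-descent w j i awj j<w aji i<j (trans (sym (cv-other j≢w)) e)

    cv-free : ∃ λ α → ∀ j → a v (ι j) ≡ true → cv j ≢ α
    cv-free = let (α , unused) = missing-value (cv ∘ f) in α , λ j avj → unused-by-neighbour unused j avj
      where
      unused-by-neighbour : ∀ {α} → (∀ x → cv (f x) ≢ α) → ∀ j → a v (ι j) ≡ true → cv j ≢ α
      unused-by-neighbour unused j avj with neighbours⊆clique j avj
      ... | x , refl = unused x

    rv : ℕ
    rv = suc (2 * rank w)

    rv-fresh : ∀ i → rv ≢ 2 * rank i
    rv-fresh i = ℕ.even≢odd (rank i) (rank w) ∘ sym

    -- v sits right next to w on the curve, so the chord v–j crosses what w–j crosses.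
    cv-non-crossing : ∀ j l q → a v (ι j) ≡ true → a (ι l) (ι q) ≡ true → cv j ≡ colour l q →
      ¬ Interleaved _<_ rv (2 * rank j) (2 * rank l) (2 * rank q)
    cv-non-crossing j l q avj alq e c = cases (j Fin.≟ w) (l Fin.≟ w) (q Fin.≟ w)
      where
      doubled : ∀ {x} → x ≢ w → 2 * rank x ≢ 2 * rank w
      doubled x≢w = x≢w ∘ rank-injective _ _ ∘ ℕ.*-cancelˡ-≡ _ _ 2
      cases : Dec (j ≡ w) → Dec (l ≡ w) → Dec (q ≡ w) → ⊥
      cases (yes refl) _ _ = ¬Interleaved-adjacent c
      cases (no j≢w) (yes refl) _ =
        proj₂ (proj₂ (proj₂ (Interleaved⇒distinct c)))
          (cong (λ x → 2 * rank x) (colour-at-w-injective j≢w avj alq (trans (sym (cv-other j≢w)) e)))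
      cases (no j≢w) (no _) (yes refl) =
        proj₁ (proj₂ (proj₂ (Interleaved⇒distinct c)))
          (cong (λ x → 2 * rank x) (colour-at-w-injective j≢w avj (trans (a-sym (ι w) (ι l)) alq)
            (trans (sym (cv-other j≢w)) (trans e (colour-sym l w)))))
      cases (no j≢w) (no l≢w) (no q≢w) =
        non-crossing w j l q (proj₁ (older-neighbour-of-w avj j≢w)) alq (trans (sym (cv-other j≢w)) e)
          (Interleaved-reflect (2 *_) (ℕ.*-cancelˡ-< 2 _ _) (Interleaved-lowerˡ (doubled l≢w) (doubled q≢w) c))

    layout : StarLayout (suc k) (suc m) a
    layout = Extension.layout a v a-sym a-irrefl L
      rv cv rv-fresh cv-injective cv-no-descent cv-free cv-non-crossing

  star-layout : ∀ {k m a} → IsKTree k m a → (∀ x y → a x y ≡ a y x) → (∀ x → a x x ≡ false) → StarLayout k m a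
  star-layout (base a _) a-sym a-irrefl = layout-on-1+k-vertices a
  star-layout {zero} (step a v f _ neighbours⊆clique _ _ kt) a-sym a-irrefl =
    extend-by-isolated a v a-sym a-irrefl isolated (star-layout kt (λ _ _ → a-sym _ _) (λ _ → a-irrefl _))
    where
    isolated : ∀ u → a v (punchIn v u) ≢ true
    isolated u avu with neighbours⊆clique u avu
    ... | () , _
  star-layout {suc k} (step a v f _ neighbours⊆clique _ clique kt) a-sym a-irrefl =
    AttachToClique.layout a v a-sym a-irrefl f neighbours⊆clique clique
      (star-layout kt (λ _ _ → a-sym _ _) (λ _ → a-irrefl _))

open StarLayouts

module UpperBound where
  open import Data.Nat using (_<_; _≤_)

  module _ (G : Graph) {k : ℕ} (h : Fin (n G) → Fin (n G) → Bool)
    (G⊆h : ∀ i j → Edge G i j → h i j ≡ true) (L : StarLayout k (n G) h) where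
    open StarLayout L
    open ParabolaDrawing G (fromℕ ∘ rank) (λ i j → rank-injective i j ∘ fromℕ-injective)

    layout-colouring : EdgeColouring G (suc k)
    layout-colouring = record { col = colour ; colSym = λ i j _ → colour-sym i j }

    private
      _∈_─_ : Fin (suc k) → Fin (n G) → Fin (n G) → Set
      α ∈ x ─ y = ColEdge layout-colouring α x y

      on-h : ∀ {α x y} → α ∈ x ─ y → h x y ≡ true
      on-h {x = x} {y} (exy , _) = G⊆h x y exy

      flip : ∀ {α x y} → α ∈ x ─ y → α ∈ y ─ x
      flip {x = x} {y} (exy , cxy) = trans (Graph.sym G y x) exy , trans (sym (colour-sym x y)) cxy

      ends-differ : ∀ {α x y} → α ∈ x ─ y → x ≢ y
      ends-differ {x = x} (exx , _) refl = true≢false (trans (sym exx) (irrefl G x))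

      same-colour : ∀ {α x y u w} → α ∈ x ─ y → α ∈ u ─ w → colour x y ≡ colour u w
      same-colour (_ , cxy) (_ , cuw) = trans cxy (sym cuw)

    -- Two distinct edges of one colour at y can neither both lead to older vertices nor form
    -- a descending path, so y is older than the other ends.
    hub-older : ∀ {α x y z} → α ∈ y ─ x → α ∈ y ─ z → x ≢ z → stage y < stage x
    hub-older {x = x} {y} {z} eyx eyz x≢z with ℕ.<-cmp (stage y) (stage x) | ℕ.<-cmp (stage z) (stage y)
    ... | tri< y<x _ _ | _ = y<x
    ... | tri≈ _ y≡x _ | _ = ⊥-elim (ends-differ eyx (stage-injective y x y≡x))
    ... | tri> _ _ x<y | tri< z<y _ _ =
      ⊥-elim (x≢z (older-colours-distinct y x z (on-h eyx) x<y (on-h eyz) z<y (same-colour eyx eyz)))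
    ... | tri> _ _ x<y | tri≈ _ z≡y _ = ⊥-elim (ends-differ eyz (sym (stage-injective z y z≡y)))
    ... | tri> _ _ x<y | tri> _ _ y<z = ⊥-elim (
      no-monochromatic-descent z y x (on-h (flip eyz)) y<z (on-h eyx) x<y (same-colour (flip eyz) eyx))

    -- A monochromatic triangle or three-edge path has two adjacent vertices that are both
    -- hubs, hence each older than the other.
    layout-star-forests : StarColouring G (suc k) layout-colouring
    layout-star-forests α =
      (λ (x , y , z , exy , eyz , ezx) →
        ℕ.<-asym (hub-older (flip exy) eyz (ends-differ ezx ∘ sym)) (hub-older exy (flip ezx) (ends-differ eyz))) ,
      (λ (w , x , y , z , w≢y , x≢z , _ , ewx , exy , eyz) →
        ℕ.<-asym (hub-older exy (flip ewx) (w≢y ∘ sym)) (hub-older (flip exy) eyz x≢z))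

    layout-non-crossing : NonCrossingClasses drawing layout-colouring
    layout-non-crossing α i j k l eij ekl ¬same cr =
      non-crossing i j k l (on-h eij) (on-h ekl) (same-colour eij ekl)
        (Interleaved-reflect fromℕ fromℕ-cancel-< (cross⇒interleaved (ends-differ eij) (ends-differ ekl) ¬same cr))

    layout⇒bsa : BsaLE G (suc k)
    layout⇒bsa = drawing , convex , layout-colouring , layout-star-forests , layout-non-crossing

  module _ {G : Graph} {t t′ : ℕ} (t≤t′ : t ≤ t′) where

    widen : EdgeColouring G t → EdgeColouring G t′
    widen c = record
      { col    = λ i j → Fin.inject≤ (col c i j) t≤t′
      ; colSym = λ i j e → cong (λ α → Fin.inject≤ α t≤t′) (colSym c i j e)
      }

    narrow : ∀ (c : EdgeColouring G t) {β x y u w} → ColEdge (widen c) β x y → ColEdge (widen c) β u w →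
      ColEdge c (col c x y) u w
    narrow c (_ , cxy) (euw , cuw) = euw , Fin.inject≤-injective t≤t′ t≤t′ _ _ (trans cuw (sym cxy))

    BsaLE-mono : BsaLE G t → BsaLE G t′
    BsaLE-mono (D , convex , c , stars , non-crossing) = D , convex , widen c ,
      (λ β → (λ (x , y , z , exy , eyz , ezx) →
                proj₁ (stars (col c x y)) (x , y , z , narrow c exy exy , narrow c exy eyz , narrow c exy ezx)) ,
             (λ (w , x , y , z , w≢y , x≢z , w≢z , ewx , exy , eyz) →
                proj₂ (stars (col c w x))
                  (w , x , y , z , w≢y , x≢z , w≢z , narrow c ewx ewx , narrow c ewx exy , narrow c ewx eyz))) ,
      λ β i j k l eij ekl → non-crossing (col c i j) i j k l (narrow c eij eij) (narrow c eij ekl)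

  treewidth≤⇒bsa≤ : ∀ G k → TreewidthLE G k → BsaLE G (suc k)
  treewidth≤⇒bsa≤ G k (k′ , k′≤k , h , h-sym , h-irrefl , h-ktree , G⊆h) =
    BsaLE-mono (s≤s k′≤k) (layout⇒bsa G h G⊆h (star-layout h-ktree h-sym h-irrefl))

  bsa≤⇒gsa≤ : ∀ {G t} → BsaLE G t → GsaLE G t
  bsa≤⇒gsa≤ (D , _ , c , stars , non-crossing) = D , c , stars , non-crossing

  gsa≤⇒sa≤ : ∀ {G t} → GsaLE G t → SaLE G t
  gsa≤⇒sa≤ (_ , c , stars , _) = c , stars

open UpperBound

module LowerBound where
  open import Data.Nat using (_*_)
  open import Data.Fin using (zero; suc)

  complete : ∀ {n} → Fin n → Fin n → Bool
  complete i j = not (does (i Fin.≟ j))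

  complete-≢ : ∀ {n} (i j : Fin n) → i ≢ j → complete i j ≡ true
  complete-≢ i j i≢j with i Fin.≟ j
  ... | yes i≡j = ⊥-elim (i≢j i≡j)
  ... | no _    = refl

  complete-irrefl : ∀ {n} (i : Fin n) → complete i i ≡ false
  complete-irrefl i with i Fin.≟ i
  ... | yes _   = refl
  ... | no i≢i  = ⊥-elim (i≢i refl)

  complete-sym : ∀ {n} (i j : Fin n) → complete i j ≡ complete j i
  complete-sym i j with i Fin.≟ j | j Fin.≟ i
  ... | yes _   | yes _   = refl
  ... | yes i≡j | no j≢i  = ⊥-elim (j≢i (sym i≡j))
  ... | no i≢j  | yes j≡i = ⊥-elim (i≢j (sym j≡i))
  ... | no _    | no _    = refl

  -- The new vertex is zero and the old vertices are shifted by suc (= punchIn zero).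
  addVertex : ∀ {m} → (Fin m → Bool) → (Fin m → Fin m → Bool) → Fin (suc m) → Fin (suc m) → Bool
  addVertex nb a zero    zero    = false
  addVertex nb a zero    (suc j) = nb j
  addVertex nb a (suc i) zero    = nb i
  addVertex nb a (suc i) (suc j) = a i j

  addVertex-sym : ∀ {m} (nb : Fin m → Bool) a → (∀ i j → a i j ≡ a j i) →
    ∀ i j → addVertex nb a i j ≡ addVertex nb a j i
  addVertex-sym nb a a-sym zero    zero    = refl
  addVertex-sym nb a a-sym zero    (suc j) = refl
  addVertex-sym nb a a-sym (suc i) zero    = refl
  addVertex-sym nb a a-sym (suc i) (suc j) = a-sym i j

  addVertex-irrefl : ∀ {m} (nb : Fin m → Bool) a → (∀ i → a i i ≡ false) → ∀ i → addVertex nb a i i ≡ false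
  addVertex-irrefl nb a a-irrefl zero    = refl
  addVertex-irrefl nb a a-irrefl (suc i) = a-irrefl i

  addVertex-ktree : ∀ {k m} (nb : Fin m → Bool) a → IsKTree k m a → (f : Fin k → Fin m) →
    (∀ x y → f x ≡ f y → x ≡ y) → (∀ u → nb u ≡ true → ∃[ x ] f x ≡ u) →
    (∀ x → nb (f x) ≡ true) → (∀ x y → x ≢ y → a (f x) (f y) ≡ true) →
    IsKTree k (suc m) (addVertex nb a)
  addVertex-ktree nb a kt f f-injective nb⊆f f⊆nb clique =
    step (addVertex nb a) zero f f-injective nb⊆f f⊆nb clique kt

  module Obstruction (k₁ : ℕ) where

    k : ℕ
    k = suc k₁

    -- Round 0 is K_{k+1}, whose vertices 1, …, k form the clique A; round r + 1 adds a vertex b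
    -- adjacent to A and then a vertex c adjacent to b and to all of A but its first vertex.
    size : ℕ → ℕ
    size zero    = suc k
    size (suc r) = suc (suc (size r))

    a-vertex : ∀ r → Fin k → Fin (size r)
    a-vertex zero    x = suc x
    a-vertex (suc r) x = suc (suc (a-vertex r x))

    in-A : ∀ r → Fin (size r) → Bool
    in-A zero    zero          = false
    in-A zero    (suc _)       = true
    in-A (suc r) zero          = false
    in-A (suc r) (suc zero)    = false
    in-A (suc r) (suc (suc u)) = in-A r u

    in-A⁻ : ∀ r → Fin (size r) → Bool
    in-A⁻ zero    zero          = false
    in-A⁻ zero    (suc zero)    = false
    in-A⁻ zero    (suc (suc _)) = true
    in-A⁻ (suc r) zero          = false
    in-A⁻ (suc r) (suc zero)    = false
    in-A⁻ (suc r) (suc (suc u)) = in-A⁻ r u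

    c-neighbours : ∀ r → Fin (suc (size r)) → Bool
    c-neighbours r zero    = true
    c-neighbours r (suc u) = in-A⁻ r u

    adjacency : ∀ r → Fin (size r) → Fin (size r) → Bool
    adjacency zero    = complete
    adjacency (suc r) = addVertex (c-neighbours r) (addVertex (in-A r) (adjacency r))

    adjacency-sym : ∀ r i j → adjacency r i j ≡ adjacency r j i
    adjacency-sym zero    = complete-sym
    adjacency-sym (suc r) = addVertex-sym _ _ (addVertex-sym _ _ (adjacency-sym r))

    adjacency-irrefl : ∀ r i → adjacency r i i ≡ false
    adjacency-irrefl zero    = complete-irrefl
    adjacency-irrefl (suc r) = addVertex-irrefl _ _ (addVertex-irrefl _ _ (adjacency-irrefl r))

    in-A-a-vertex : ∀ r x → in-A r (a-vertex r x) ≡ true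
    in-A-a-vertex zero    x = refl
    in-A-a-vertex (suc r) x = in-A-a-vertex r x

    in-A⇒a-vertex : ∀ r u → in-A r u ≡ true → ∃[ x ] a-vertex r x ≡ u
    in-A⇒a-vertex zero    (suc u)       _ = u , refl
    in-A⇒a-vertex (suc r) (suc (suc u)) e with in-A⇒a-vertex r u e
    ... | x , refl = x , refl

    in-A⁻-a-vertex : ∀ r y → in-A⁻ r (a-vertex r (suc y)) ≡ true
    in-A⁻-a-vertex zero    y = refl
    in-A⁻-a-vertex (suc r) y = in-A⁻-a-vertex r y

    in-A⁻⇒a-vertex : ∀ r u → in-A⁻ r u ≡ true → ∃[ y ] a-vertex r (suc y) ≡ u
    in-A⁻⇒a-vertex zero    (suc (suc u)) _ = u , refl
    in-A⁻⇒a-vertex (suc r) (suc (suc u)) e with in-A⁻⇒a-vertex r u e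
    ... | y , refl = y , refl

    a-vertex-injective : ∀ r x y → a-vertex r x ≡ a-vertex r y → x ≡ y
    a-vertex-injective zero    x y e = Fin.suc-injective e
    a-vertex-injective (suc r) x y e = a-vertex-injective r x y (Fin.suc-injective (Fin.suc-injective e))

    A-clique : ∀ r x y → x ≢ y → adjacency r (a-vertex r x) (a-vertex r y) ≡ true
    A-clique zero    x y x≢y = complete-≢ (suc x) (suc y) (x≢y ∘ Fin.suc-injective)
    A-clique (suc r) x y x≢y = A-clique r x y x≢y

    c-clique : ∀ r → Fin k → Fin (suc (size r))
    c-clique r zero    = zero
    c-clique r (suc y) = suc (a-vertex r (suc y))

    c-clique-injective : ∀ r x y → c-clique r x ≡ c-clique r y → x ≡ y
    c-clique-injective r zero    zero    _ = refl
    c-clique-injective r (suc x) (suc y) e = a-vertex-injective r (suc x) (suc y) (Fin.suc-injective e)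

    c-neighbours⇒c-clique : ∀ r u → c-neighbours r u ≡ true → ∃[ x ] c-clique r x ≡ u
    c-neighbours⇒c-clique r zero    _ = zero , refl
    c-neighbours⇒c-clique r (suc u) e with in-A⁻⇒a-vertex r u e
    ... | y , refl = suc y , refl

    c-neighbours-c-clique : ∀ r x → c-neighbours r (c-clique r x) ≡ true
    c-neighbours-c-clique r zero    = refl
    c-neighbours-c-clique r (suc y) = in-A⁻-a-vertex r y

    c-clique-adjacent : ∀ r x y → x ≢ y → addVertex (in-A r) (adjacency r) (c-clique r x) (c-clique r y) ≡ true
    c-clique-adjacent r zero    zero    x≢y = ⊥-elim (x≢y refl)
    c-clique-adjacent r zero    (suc y) _   = in-A-a-vertex r (suc y)
    c-clique-adjacent r (suc x) zero    _   = in-A-a-vertex r (suc x)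
    c-clique-adjacent r (suc x) (suc y) x≢y = A-clique r (suc x) (suc y) x≢y

    adjacency-ktree : ∀ r → IsKTree k (size r) (adjacency r)
    adjacency-ktree zero    = base complete complete-≢
    adjacency-ktree (suc r) = addVertex-ktree (c-neighbours r) _
      (addVertex-ktree (in-A r) (adjacency r) (adjacency-ktree r)
        (a-vertex r) (a-vertex-injective r) (in-A⇒a-vertex r) (in-A-a-vertex r) (A-clique r))
      (c-clique r) (c-clique-injective r) (c-neighbours⇒c-clique r) (c-neighbours-c-clique r) (c-clique-adjacent r)

    b-vertex : ∀ r → Fin r → Fin (size r)
    b-vertex (suc r) zero    = suc zero
    b-vertex (suc r) (suc i) = suc (suc (b-vertex r i))

    c-vertex : ∀ r → Fin r → Fin (size r)
    c-vertex (suc r) zero    = zero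
    c-vertex (suc r) (suc i) = suc (suc (c-vertex r i))

    b-vertex-injective : ∀ r i j → b-vertex r i ≡ b-vertex r j → i ≡ j
    b-vertex-injective (suc r) zero    zero    _ = refl
    b-vertex-injective (suc r) (suc i) (suc j) e =
      cong suc (b-vertex-injective r i j (Fin.suc-injective (Fin.suc-injective e)))

    b-adjacent-A : ∀ r i x → adjacency r (b-vertex r i) (a-vertex r x) ≡ true
    b-adjacent-A (suc r) zero    x = in-A-a-vertex r x
    b-adjacent-A (suc r) (suc i) x = b-adjacent-A r i x

    b-adjacent-c : ∀ r i → adjacency r (b-vertex r i) (c-vertex r i) ≡ true
    b-adjacent-c (suc r) zero    = refl
    b-adjacent-c (suc r) (suc i) = b-adjacent-c r i

    c-vertex∉A : ∀ r i → in-A r (c-vertex r i) ≡ false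
    c-vertex∉A (suc r) zero    = refl
    c-vertex∉A (suc r) (suc i) = c-vertex∉A r i

    c-vertex≢a-vertex : ∀ r i x → c-vertex r i ≢ a-vertex r x
    c-vertex≢a-vertex r i x e =
      true≢false (trans (sym (in-A-a-vertex r x)) (trans (cong (in-A r) (sym e)) (c-vertex∉A r i)))

    rounds : ℕ
    rounds = suc (k * k)

    graph : Graph
    graph = record
      { n = size rounds ; adj = adjacency rounds ; sym = adjacency-sym rounds ; irrefl = adjacency-irrefl rounds }

    treewidth≤k : TreewidthLE graph k
    treewidth≤k = k , ℕ.≤-refl , adjacency rounds , adjacency-sym rounds , adjacency-irrefl rounds ,
                  adjacency-ktree rounds , λ _ _ e → e

    module _ (c : EdgeColouring graph k) (stars : StarColouring graph k c) where

      flip : ∀ {α u w} → ColEdge c α u w → ColEdge c α w u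
      flip {u = u} {w} (euw , cuw) = trans (adjacency-sym rounds w u) euw , trans (sym (colSym c u w euw)) cuw

      star-leaf : ∀ {α b x y z} → ColEdge c α b x → ColEdge c α b y → x ≢ y → ColEdge c α y z → z ≡ b
      star-leaf {α} {b} {x} {y} {z} ebx eby x≢y eyz with z Fin.≟ b | z Fin.≟ x
      ... | yes z≡b | _ = z≡b
      ... | no _ | yes refl = ⊥-elim (proj₁ (stars α) (b , x , y , ebx , flip eyz , flip eby))
      ... | no z≢b | no z≢x =
        ⊥-elim (proj₂ (stars α) (z , y , b , x , z≢b , x≢y ∘ sym , z≢x , flip eyz , flip eby , ebx))

      b-neighbour : Fin rounds → Fin (suc k) → Fin (size rounds)
      b-neighbour j zero    = c-vertex rounds j
      b-neighbour j (suc x) = a-vertex rounds x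

      b-neighbour-adjacent : ∀ j p → adjacency rounds (b-vertex rounds j) (b-neighbour j p) ≡ true
      b-neighbour-adjacent j zero    = b-adjacent-c rounds j
      b-neighbour-adjacent j (suc x) = b-adjacent-A rounds j x

      b-neighbour-injective : ∀ j p q → b-neighbour j p ≡ b-neighbour j q → p ≡ q
      b-neighbour-injective j zero    zero    _ = refl
      b-neighbour-injective j zero    (suc y) e = ⊥-elim (c-vertex≢a-vertex rounds j y e)
      b-neighbour-injective j (suc x) zero    e = ⊥-elim (c-vertex≢a-vertex rounds j x (sym e))
      b-neighbour-injective j (suc x) (suc y) e = cong suc (a-vertex-injective rounds x y e)

      record Leaf (j : Fin rounds) : Set where
        field
          vertex : Fin k
          colour : Fin k
          edge   : ColEdge c colour (b-vertex rounds j) (a-vertex rounds vertex)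
          only   : ∀ z → ColEdge c colour (a-vertex rounds vertex) z → z ≡ b-vertex rounds j

      -- b has k + 1 neighbours but only k colours are available.
      find-leaf : ∀ j → Leaf j
      find-leaf j with Fin.pigeonhole (ℕ.n<1+n k) (λ p → col c (b-vertex rounds j) (b-neighbour j p))
      ... | p , suc x , p<q , same = record
        { vertex = x
        ; colour = col c (b-vertex rounds j) (a-vertex rounds x)
        ; edge   = b-neighbour-adjacent j (suc x) , refl
        ; only   = λ z → star-leaf (b-neighbour-adjacent j p , same) (b-neighbour-adjacent j (suc x) , refl)
                                 (λ e → ℕ.<-irrefl (cong toℕ (b-neighbour-injective j p (suc x) e)) p<q)
        }

      code : Fin rounds → Fin (k * k)
      code j = Fin.combine (Leaf.vertex (find-leaf j)) (Leaf.colour (find-leaf j))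

      code-injective : ∀ {i j} → code i ≡ code j → i ≡ j
      code-injective {i} {j} e = b-vertex-injective rounds i j (sym (Leaf.only Lᵢ (b-vertex rounds j) edge-to-bⱼ))
        where
        Lᵢ : Leaf i
        Lᵢ = find-leaf i
        Lⱼ : Leaf j
        Lⱼ = find-leaf j
        same-leaf : Leaf.vertex Lᵢ ≡ Leaf.vertex Lⱼ × Leaf.colour Lᵢ ≡ Leaf.colour Lⱼ
        same-leaf = Fin.combine-injective _ _ _ _ e
        edge-to-bⱼ : ColEdge c (Leaf.colour Lᵢ) (a-vertex rounds (Leaf.vertex Lᵢ)) (b-vertex rounds j)
        edge-to-bⱼ = subst₂ (λ x α → ColEdge c α (a-vertex rounds x) (b-vertex rounds j))
          (sym (proj₁ same-leaf)) (sym (proj₂ same-leaf)) (flip (Leaf.edge Lⱼ))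

    ¬sa≤k : ¬ SaLE graph k
    ¬sa≤k (c , stars) = ℕ.<-irrefl refl (Fin.injective⇒≤ (code-injective c stars))

corollary1 : (k : ℕ) → k ≥ 1 →
    MaxOverTwEq SaLE k × MaxOverTwEq GsaLE k × MaxOverTwEq BsaLE k
corollary1 (suc k₁) (s≤s z≤n) =
  (sa≤ , graph , treewidth≤k , sa≤ graph treewidth≤k , ¬sa≤k) ,
  (gsa≤ , graph , treewidth≤k , gsa≤ graph treewidth≤k , ¬sa≤k ∘ gsa≤⇒sa≤) ,
  (bsa≤ , graph , treewidth≤k , bsa≤ graph treewidth≤k , ¬sa≤k ∘ gsa≤⇒sa≤ ∘ bsa≤⇒gsa≤)
  where
  open LowerBound.Obstruction k₁
  bsa≤ : ∀ G → TreewidthLE G k → BsaLE G (suc k)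
  bsa≤ G = treewidth≤⇒bsa≤ G k
  gsa≤ : ∀ G → TreewidthLE G k → GsaLE G (suc k)
  gsa≤ G = bsa≤⇒gsa≤ ∘ bsa≤ G
  sa≤ : ∀ G → TreewidthLE G k → SaLE G (suc k)
  sa≤ G = gsa≤⇒sa≤ ∘ gsa≤ G
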